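{- Let $n \ge 2$ and let $q$ be any prime power. Then $\mathrm{GL}(n,q)$ is generated by a set of $n$ instructions.
   Context: For $1 \le i \le n$ and $v \in \mathrm{GF}(q)^n$ with $v_i \neq 0$, let $S(i,v)$ denote the $n\times n$ matrix over $\mathrm{GF}(q)$ which agrees with the identity matrix except that its $i$-th row is $v$; such matrices are called instructions. -}

module Defs where

open import Level using (Level; _⊔_) renaming (suc to lsuc)
open import Data.Nat using (ℕ)
open import Data.Fin using (Fin; zero; suc)
import Data.Fin as Fin
open import Data.Bool using (if_then_else_)
open import Data.Product using (∃; _×_; _,_; proj₁; proj₂)
open import Relation.Nullary using (¬_; does)
open import Relation.Binary using (Decidable)
open import Relation.Binary.PropositionalEquality using (_≡_)
open import Algebra.Bundles using (CommutativeRing)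

-- Its cardinality q is a prime power, and every
-- GF(q) arises this way.
record FiniteField (c ℓ : Level) : Set (lsuc (c ⊔ ℓ)) where
  field
    commRing : CommutativeRing c ℓ
  open CommutativeRing commRing public hiding (ring)
  field
    1≉0       : ¬ (1# ≈ 0#)
    inverse   : ∀ x → ¬ (x ≈ 0#) → ∃ λ y → x * y ≈ 1#
    _≟_       : Decidable _≈_
    size      : ℕ
    enum      : Fin size → Carrier
    enum-surj : ∀ x → ∃ λ i → enum i ≈ x

module Matrices {c ℓ : Level} (F : FiniteField c ℓ) (n : ℕ) where
  open FiniteField F

  Mat : Set c
  Mat = Fin n → Fin n → Carrier

  Vec : Set c
  Vec = Fin n → Carrier

  _≈M_ : Mat → Mat → Set ℓ
  A ≈M B = ∀ i j → A i j ≈ B i j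

  ∑ : ∀ {m} → (Fin m → Carrier) → Carrier
  ∑ {ℕ.zero}  f = 0#
  ∑ {ℕ.suc m} f = f Fin.zero + ∑ (λ k → f (Fin.suc k))

  _⊗_ : Mat → Mat → Mat
  (A ⊗ B) i j = ∑ (λ k → A i k * B k j)

  I : Mat
  I i j = if does (i Fin.≟ j) then 1# else 0#

  Invertible : Mat → Set (c ⊔ ℓ)
  Invertible A = ∃ λ B → ((A ⊗ B) ≈M I) × ((B ⊗ A) ≈M I)

  S : Fin n → Vec → Mat
  S i v r j = if does (r Fin.≟ i) then v j else I r j

  IsInstruction : Mat → Set (c ⊔ ℓ)
  IsInstruction A = ∃ λ i → ∃ λ (v : Vec) → (¬ (v i ≈ 0#)) × (A ≈M S i v)

  data ⟨_⟩ {k : ℕ} (gs : Fin k → Mat) : Mat → Set (c ⊔ ℓ) where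
    gen  : ∀ j → ⟨ gs ⟩ (gs j)
    one  : ⟨ gs ⟩ I
    mul  : ∀ {A B} → ⟨ gs ⟩ A → ⟨ gs ⟩ B → ⟨ gs ⟩ (A ⊗ B)
    inv  : ∀ {A B} → ⟨ gs ⟩ A → (A ⊗ B) ≈M I → (B ⊗ A) ≈M I → ⟨ gs ⟩ B
    resp : ∀ {A B} → ⟨ gs ⟩ A → A ≈M B → ⟨ gs ⟩ B

  GeneratesGL : ∀ {k} → (Fin k → Mat) → Set (c ⊔ ℓ)
  GeneratesGL gs = ∀ M → Invertible M → ⟨ gs ⟩ M

module Submission where

-- Let o be the first and L the last row index, and let g generate the cyclic
-- group F*.  The n instructions are the transvections T j (j+1) 1, adding row
-- j+1 to row j for j < L, and y = E L o g 1, replacing row L by g·(row L) +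
-- (row o).  The
-- subgroup H they generate contains every transvection and every dilation:
-- T r c 1 for r < c are commutators of generators; T L o 1 and then
-- D L g = T L o (-1)·y follow from two relations with y; D L d for all d ≠ 0
-- since g generates F*; and all T r c a and D r d by conjugation and
-- commutators.  Gaussian elimination then writes every invertible matrix
-- as a product of transvections and dilations.

open import Level using (Level; _⊔_)
open import Data.Nat as ℕ using (ℕ; zero; suc; _≤_; _<_; s≤s; z≤n)
import Data.Nat.Properties as ℕP
open import Data.Nat.Divisibility using (_∣_; divides; ∣-antisym; ∣⇒≤; m%n≡0⇒n∣m)
open import Data.Nat.DivMod using (_%_; _/_; m≡m%n+[m/n]*n; m%n<n)
open import Data.Nat.Coprimality using (Coprime; coprime-divisor)
import Data.Nat.Coprimality as Coprime
open import Data.Nat.Primality using (prime⇒nonZero)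
open import Data.Integer as ℤ using (ℤ; +_; -[1+_]; _⊖_)
import Data.Integer.Properties as ℤP
open import Data.Fin as Fin using (Fin; zero; suc; toℕ; #_)
import Data.Fin.Properties as FinP
open import Data.Vec using (Vec; []; _∷_; lookup; tabulate)
import Data.Vec.Properties as VecP
open import Data.List using (List; []; _∷_; _++_)
open import Data.List.Relation.Unary.All using (All; []; _∷_)
open import Data.Bool using (if_then_else_)
open import Data.Maybe using (just; nothing)
open import Data.Product using (∃; ∃₂; _×_; _,_; proj₁; proj₂)
open import Data.Sum using (_⊎_; inj₁; inj₂; [_,_]′)
open import Data.Empty using (⊥; ⊥-elim)
open import Function using (_∘_)
open import Relation.Nullary using (¬_; yes; no; does)
open import Relation.Nullary.Decidable using (_×-dec_; ¬?)
open import Relation.Unary using (Decidable)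
open import Relation.Binary.PropositionalEquality as P using (_≡_; _≢_)
open import Relation.Binary.Definitions using (WeaklyDecidable; tri<; tri≈; tri>)
open import Algebra.Bundles using (RawRing; CommutativeRing)
open import Algebra.Solver.Ring.AlmostCommutativeRing
  using (fromCommutativeRing; _-Raw-AlmostCommutative⟶_; Induced-equivalence)
open import Defs

module FieldTheory {c ℓ : Level} (F : FiniteField c ℓ) where

  open FiniteField F public hiding (zero)
  open import Algebra.Properties.Ring (CommutativeRing.ring commRing) public
  open import Algebra.Properties.AbelianGroup +-abelianGroup public using (⁻¹-∙-comm)
  open import Algebra.Properties.Semiring.Mult.TCOptimised (CommutativeRing.semiring commRing)
    using (1+×; ×-homo-+; ×1-homo-*) renaming (_×_ to _×′_)
  open import Relation.Binary.Reasoning.Setoid setoid public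

  -- The canonical ring homomorphism ℤ → F; it lets the ring solver work
  -- with integer coefficients, whose equality is decidable by computation.
  ℤ→F : ℤ → Carrier
  ℤ→F (+ n)    = n ×′ 1#
  ℤ→F -[1+ n ] = - (suc n ×′ 1#)

  ℤ→F-neg : ∀ i → ℤ→F (ℤ.- i) ≈ - ℤ→F i
  ℤ→F-neg (+ zero)  = sym -0#≈0#
  ℤ→F-neg (+ suc n) = refl
  ℤ→F-neg -[1+ n ]  = sym (-‿involutive _)

  -- (1 + a) - (1 + b) ≈ a - b, by hand since the solver is not yet available
  1+-cancel : ∀ a b → (1# + a) - (1# + b) ≈ a - b
  1+-cancel a b = begin
    (1# + a) + - (1# + b)   ≈⟨ +-congˡ (sym (⁻¹-∙-comm 1# b)) ⟩
    (1# + a) + (- 1# + - b) ≈⟨ +-congʳ (+-comm 1# a) ⟩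
    (a + 1#) + (- 1# + - b) ≈⟨ +-assoc a 1# _ ⟩
    a + (1# + (- 1# + - b)) ≈⟨ +-congˡ (sym (+-assoc 1# (- 1#) (- b))) ⟩
    a + ((1# - 1#) + - b)   ≈⟨ +-congˡ (+-congʳ (-‿inverseʳ 1#)) ⟩
    a + (0# + - b)          ≈⟨ +-congˡ (+-identityˡ (- b)) ⟩
    a - b                   ∎

  ℤ→F-⊖ : ∀ m n → ℤ→F (m ⊖ n) ≈ m ×′ 1# - n ×′ 1#
  ℤ→F-⊖ zero    zero    = sym (-‿inverseʳ 0#)
  ℤ→F-⊖ (suc m) zero    = sym (trans (+-congˡ -0#≈0#) (+-identityʳ _))
  ℤ→F-⊖ zero    (suc n) = sym (+-identityˡ _)
  ℤ→F-⊖ (suc m) (suc n) = begin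
    ℤ→F (suc m ⊖ suc n)              ≡⟨ P.cong ℤ→F (ℤP.[1+m]⊖[1+n]≡m⊖n m n) ⟩
    ℤ→F (m ⊖ n)                      ≈⟨ ℤ→F-⊖ m n ⟩
    m ×′ 1# - n ×′ 1#                ≈⟨ sym (1+-cancel _ _) ⟩
    (1# + m ×′ 1#) - (1# + n ×′ 1#)  ≈⟨ sym (+-cong (1+× m 1#) (-‿cong (1+× n 1#))) ⟩
    suc m ×′ 1# - suc n ×′ 1#        ∎

  ℤ→F-+ : ∀ i j → ℤ→F (i ℤ.+ j) ≈ ℤ→F i + ℤ→F j
  ℤ→F-+ -[1+ m ] -[1+ n ] = begin
    - (suc (suc (m ℕ.+ n)) ×′ 1#)      ≡⟨ P.cong (λ k → - (suc k ×′ 1#)) (P.sym (ℕP.+-suc m n)) ⟩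
    - ((suc m ℕ.+ suc n) ×′ 1#)        ≈⟨ -‿cong (×-homo-+ 1# (suc m) (suc n)) ⟩
    - (suc m ×′ 1# + suc n ×′ 1#)      ≈⟨ sym (⁻¹-∙-comm _ _) ⟩
    - (suc m ×′ 1#) + - (suc n ×′ 1#)  ∎
  ℤ→F-+ -[1+ m ] (+ n)    = trans (ℤ→F-⊖ n (suc m)) (+-comm _ _)
  ℤ→F-+ (+ m)    -[1+ n ] = ℤ→F-⊖ m (suc n)
  ℤ→F-+ (+ m)    (+ n)    = ×-homo-+ 1# m n

  ℤ→F-*⁺ : ∀ m j → ℤ→F (+ m ℤ.* j) ≈ ℤ→F (+ m) * ℤ→F j
  ℤ→F-*⁺ m (+ n) = begin
    ℤ→F (+ m ℤ.* + n)  ≡⟨ P.cong ℤ→F (P.sym (ℤP.pos-* m n)) ⟩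
    (m ℕ.* n) ×′ 1#    ≈⟨ ×1-homo-* m n ⟩
    m ×′ 1# * n ×′ 1#  ∎
  ℤ→F-*⁺ m -[1+ n ] = begin
    ℤ→F (+ m ℤ.* -[1+ n ])        ≡⟨ P.cong ℤ→F (P.sym (ℤP.neg-distribʳ-* (+ m) (+ suc n))) ⟩
    ℤ→F (ℤ.- (+ m ℤ.* + suc n))   ≈⟨ ℤ→F-neg (+ m ℤ.* + suc n) ⟩
    - ℤ→F (+ m ℤ.* + suc n)       ≈⟨ -‿cong (ℤ→F-*⁺ m (+ suc n)) ⟩
    - (ℤ→F (+ m) * ℤ→F (+ suc n)) ≈⟨ -‿distribʳ-* _ _ ⟩
    ℤ→F (+ m) * ℤ→F -[1+ n ]      ∎

  ℤ→F-* : ∀ i j → ℤ→F (i ℤ.* j) ≈ ℤ→F i * ℤ→F j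
  ℤ→F-* (+ m)    j = ℤ→F-*⁺ m j
  ℤ→F-* -[1+ m ] j = begin
    ℤ→F (-[1+ m ] ℤ.* j)          ≡⟨ P.cong ℤ→F (P.sym (ℤP.neg-distribˡ-* (+ suc m) j)) ⟩
    ℤ→F (ℤ.- (+ suc m ℤ.* j))     ≈⟨ ℤ→F-neg (+ suc m ℤ.* j) ⟩
    - ℤ→F (+ suc m ℤ.* j)         ≈⟨ -‿cong (ℤ→F-*⁺ (suc m) j) ⟩
    - (ℤ→F (+ suc m) * ℤ→F j)     ≈⟨ -‿distribˡ-* _ _ ⟩
    ℤ→F -[1+ m ] * ℤ→F j          ∎

  ℤ→F-morphism : CommutativeRing.rawRing ℤP.+-*-commutativeRing
                   -Raw-AlmostCommutative⟶ fromCommutativeRing commRing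
  ℤ→F-morphism = record
    { ⟦_⟧    = ℤ→F
    ; +-homo = ℤ→F-+
    ; *-homo = ℤ→F-*
    ; -‿homo = ℤ→F-neg
    ; 0-homo = refl
    ; 1-homo = refl
    }

  private
    ℤ-coeff≟ : WeaklyDecidable (Induced-equivalence ℤ→F-morphism)
    ℤ-coeff≟ i j with i ℤ.≟ j
    ... | yes P.refl = just refl
    ... | no _       = nothing

  open import Algebra.Solver.Ring (CommutativeRing.rawRing ℤP.+-*-commutativeRing)
    (fromCommutativeRing commRing) ℤ→F-morphism ℤ-coeff≟ public
    using (solve; _:=_; _:+_; _:*_; :-_; _:-_; con; Polynomial)

  ≈-dec : ∀ x y → (x ≈ y) ⊎ (x ≉ y)
  ≈-dec x y with x ≟ y
  ... | yes x≈y = inj₁ x≈y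
  ... | no  x≉y = inj₂ x≉y

  _⁻¹[_] : (x : Carrier) → x ≉ 0# → Carrier
  x ⁻¹[ x≉0 ] = proj₁ (inverse x x≉0)

  ⁻¹-inverseʳ : ∀ x (x≉0 : x ≉ 0#) → x * x ⁻¹[ x≉0 ] ≈ 1#
  ⁻¹-inverseʳ x x≉0 = proj₂ (inverse x x≉0)

  ⁻¹-inverseˡ : ∀ x (x≉0 : x ≉ 0#) → x ⁻¹[ x≉0 ] * x ≈ 1#
  ⁻¹-inverseˡ x x≉0 = trans (*-comm _ _) (⁻¹-inverseʳ x x≉0)

  ⁻¹-nonzero : ∀ x (x≉0 : x ≉ 0#) → x ⁻¹[ x≉0 ] ≉ 0#
  ⁻¹-nonzero x x≉0 x⁻¹≈0 = 1≉0 (begin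
    1#              ≈⟨ sym (⁻¹-inverseʳ x x≉0) ⟩
    x * x ⁻¹[ x≉0 ] ≈⟨ *-congˡ x⁻¹≈0 ⟩
    x * 0#          ≈⟨ zeroʳ x ⟩
    0#              ∎)

  *-cancelˡ : ∀ {x a b} → x ≉ 0# → x * a ≈ x * b → a ≈ b
  *-cancelˡ {x} {a} {b} x≉0 xa≈xb = begin
    a                        ≈⟨ sym (*-identityˡ a) ⟩
    1# * a                   ≈⟨ *-congʳ (sym (⁻¹-inverseˡ x x≉0)) ⟩
    (x ⁻¹[ x≉0 ] * x) * a    ≈⟨ *-assoc _ _ _ ⟩
    x ⁻¹[ x≉0 ] * (x * a)    ≈⟨ *-congˡ xa≈xb ⟩
    x ⁻¹[ x≉0 ] * (x * b)    ≈⟨ sym (*-assoc _ _ _) ⟩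
    (x ⁻¹[ x≉0 ] * x) * b    ≈⟨ *-congʳ (⁻¹-inverseˡ x x≉0) ⟩
    1# * b                   ≈⟨ *-identityˡ b ⟩
    b                        ∎

  zero-product : ∀ {x y} → x ≉ 0# → x * y ≈ 0# → y ≈ 0#
  zero-product x≉0 xy≈0 = *-cancelˡ x≉0 (trans xy≈0 (sym (zeroʳ _)))

  *-nonzero : ∀ {x y} → x ≉ 0# → y ≉ 0# → x * y ≉ 0#
  *-nonzero x≉0 y≉0 xy≈0 = y≉0 (zero-product x≉0 xy≈0)

  -1≉0 : - 1# ≉ 0#
  -1≉0 -1≈0 = 1≉0 (trans (sym (-‿involutive 1#)) (trans (-‿cong -1≈0) -0#≈0#))

  open import Algebra.Properties.CommutativeSemiring.Exp (CommutativeRing.commutativeSemiring commRing)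
    public using (_^_; ^-congˡ; ^-congʳ; ^-homo-*; ^-assocʳ; ^-distrib-*)

  1^n≈1 : ∀ n → 1# ^ n ≈ 1#
  1^n≈1 zero    = refl
  1^n≈1 (suc n) = trans (*-identityˡ _) (1^n≈1 n)

  ^-nonzero : ∀ {x} n → x ≉ 0# → x ^ n ≉ 0#
  ^-nonzero zero    x≉0 = 1≉0
  ^-nonzero (suc n) x≉0 = *-nonzero x≉0 (^-nonzero n x≉0)

module PrimePowers where
  open import Data.Nat
  open import Data.Nat.Properties
  open import Data.Nat.Divisibility
  open import Data.Nat.Primality using (Prime; prime⇒irreducible)
  open import Data.Nat.Primality.Factorisation using (factorise)
  open import Data.Nat.GCD using (gcd; gcd[m,n]∣m; gcd[m,n]∣n; gcd-greatest)
  open import Data.Nat.ListAction using (product)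
  open import Data.Nat.Induction using (<-wellFounded)
  open import Induction.WellFounded using (Acc; acc)
  open import Data.Nat.Tactic.RingSolver using (solve-∀)
  open import Relation.Binary.PropositionalEquality

  prime>1 : ∀ {p} → Prime p → 1 < p
  prime>1 {2+ _} _ = s≤s (s≤s z≤n)

  primeDivisor : ∀ t → 1 < t → ∃ λ p → Prime p × p ∣ t
  primeDivisor 1 (s≤s ())
  primeDivisor (2+ t) _ with factorise (2+ t)
  ... | record { factors = [] ; isFactorisation = () }
  ... | record { factors = p ∷ ps ; isFactorisation = eq ; factorsPrime = p-prime ∷ _ } =
    p , p-prime , divides (product ps) (trans eq (*-comm p (product ps)))

  splitPrime : ∀ {p} → Prime p → ∀ n → 0 < n → ∃₂ λ j n' → n ≡ p ^ j * n' × ¬ p ∣ n'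
  splitPrime {p} p-prime n 0<n = go n 0<n (<-wellFounded n)
    where
    go : ∀ n → 0 < n → Acc _<_ n → ∃₂ λ j n' → n ≡ p ^ j * n' × ¬ p ∣ n'
    go n 0<n (acc rec) with p ∣? n
    ... | no p∤n = 0 , n , sym (+-identityʳ n) , p∤n
    ... | yes (divides zero n≡0*p) = ⊥-elim (<⇒≱ 0<n (≤-reflexive n≡0*p))
    ... | yes (divides q@(suc _) n≡q*p) with go q (s≤s z≤n) (rec q<n)
      where
      instance _ = prime⇒nonZero p-prime
      q<n : q < n
      q<n = subst (q <_) (sym n≡q*p) (m<m*n q p (prime>1 p-prime))
    ... | j , n' , q≡pʲn' , p∤n' = suc j , n' , trans n≡q*p (trans (cong (_* p) q≡pʲn') (lemma (p ^ j) n' p)) , p∤n'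
      where
      lemma : ∀ a b c → a * b * c ≡ c * a * b
      lemma = solve-∀

  -- If s ∤ e, some prime p divides s to a higher power p ^ k than the
  -- power p ^ j dividing e: take p dividing t = s / gcd s e > 1; were
  -- k ≤ j, then p ^ k ∣ gcd s e and p ^ (k + 1) ∣ t · gcd s e = s.
  excessPrime : ∀ s e → 0 < s → 0 < e → ¬ s ∣ e →
    ∃ λ p → ∃₂ λ k j → ∃₂ λ s' e' →
      Prime p × s ≡ s' * p ^ k × e ≡ p ^ j * e' × ¬ p ∣ e' × j < k
  excessPrime s e 0<s 0<e s∤e with gcd[m,n]∣m s e
  ... | divides zero s≡0 = ⊥-elim (<⇒≱ 0<s (≤-reflexive s≡0))
  ... | divides 1 s≡gcd = ⊥-elim (s∤e (subst (_∣ e) (sym (trans s≡gcd (+-identityʳ _))) (gcd[m,n]∣n s e)))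
  ... | divides t@(2+ _) s≡t*gcd with primeDivisor t (s≤s (s≤s z≤n))
  ... | p , p-prime , divides a t≡a*p with splitPrime p-prime s 0<s | splitPrime p-prime e 0<e
  ... | k , s' , s≡pᵏs' , p∤s' | j , e' , e≡pʲe' , p∤e' with j <? k
  ... | yes j<k = p , k , j , s' , e' , p-prime , trans s≡pᵏs' (*-comm (p ^ k) s') , e≡pʲe' , p∤e' , j<k
  ... | no j≮k = ⊥-elim (p∤s' (divides (a * b) (*-cancelˡ-≡ s' (a * b * p) (p ^ k) {{m^n≢0 p k}} chain)))
    where
    instance _ = prime⇒nonZero p-prime
    -- p ^ k divides e as well, hence gcd s e = b * p ^ k
    pᵏ∣e : p ^ k ∣ e
    pᵏ∣e = divides (p ^ (j ∸ k) * e') (begin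
      e                            ≡⟨ e≡pʲe' ⟩
      p ^ j * e'                   ≡⟨ cong (λ x → p ^ x * e') (sym (m+[n∸m]≡n (≮⇒≥ j≮k))) ⟩
      p ^ (k + (j ∸ k)) * e'       ≡⟨ cong (_* e') (^-distribˡ-+-* p k (j ∸ k)) ⟩
      p ^ k * p ^ (j ∸ k) * e'     ≡⟨ lemma (p ^ k) (p ^ (j ∸ k)) e' ⟩
      p ^ (j ∸ k) * e' * p ^ k     ∎)
      where
      open ≡-Reasoning
      lemma : ∀ x y z → x * y * z ≡ y * z * x
      lemma = solve-∀
    pᵏ∣gcd : p ^ k ∣ gcd s e
    pᵏ∣gcd = gcd-greatest (divides s' (trans s≡pᵏs' (*-comm (p ^ k) s'))) pᵏ∣e
    b : ℕ
    b = _∣_.quotient pᵏ∣gcd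
    gcd≡b*pᵏ : gcd s e ≡ b * p ^ k
    gcd≡b*pᵏ = _∣_.equality pᵏ∣gcd
    -- so s = a p · b p ^ k and p divides s' = s / p ^ k
    chain : p ^ k * s' ≡ p ^ k * (a * b * p)
    chain = begin
      p ^ k * s'           ≡⟨ sym s≡pᵏs' ⟩
      s                    ≡⟨ s≡t*gcd ⟩
      t * gcd s e          ≡⟨ cong₂ _*_ t≡a*p gcd≡b*pᵏ ⟩
      a * p * (b * p ^ k)  ≡⟨ lemma a p b (p ^ k) ⟩
      p ^ k * (a * b * p)  ∎
      where
      open ≡-Reasoning
      lemma : ∀ a p b q → a * p * (b * q) ≡ q * (a * b * p)
      lemma = solve-∀

  prime∤⇒coprime : ∀ {p n} → Prime p → ¬ p ∣ n → Coprime p n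
  prime∤⇒coprime p-prime p∤n (d∣p , d∣n) with prime⇒irreducible p-prime d∣p
  ... | inj₁ d≡1 = d≡1
  ... | inj₂ refl = ⊥-elim (p∤n d∣n)

  coprime-^ : ∀ {p n} → Coprime p n → ∀ k → Coprime (p ^ k) n
  coprime-^ cop zero    (d∣1 , _)     = ∣1⇒≡1 d∣1
  coprime-^ cop (suc k) (d∣ppᵏ , d∣n) =
    coprime-^ cop k (coprime-divisor (λ (c∣d , c∣p) → cop (c∣p , ∣-trans c∣d d∣n)) d∣ppᵏ , d∣n)

  coprime-product-∣ : ∀ {r t k} → Coprime r t → r ∣ k * t → t ∣ k * r → r * t ∣ k
  coprime-product-∣ {r} {t} {k} r⊥t r∣kt t∣kr with coprime-divisor r⊥t (subst (r ∣_) (*-comm k t) r∣kt)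
  ... | divides a k≡a*r with coprime-divisor (Coprime.sym r⊥t) (subst (t ∣_) (trans k≡a*r (*-comm a r)) t∣k)
    where t∣k = coprime-divisor (Coprime.sym r⊥t) (subst (t ∣_) (*-comm k r) t∣kr)
  ... | divides b a≡b*t = divides b (trans k≡a*r (trans (cong (_* r) a≡b*t) (trans (*-assoc b t r) (cong (b *_) (*-comm t r)))))

least : ∀ {p} (Q : ℕ → Set p) → Decidable Q → ∀ n → Q n → ∃ λ m → Q m × (∀ k → k < m → ¬ Q k)
least Q Q? n Qn with search (suc n)
  where
  search : ∀ i → (∀ k → k < i → ¬ Q k) ⊎ (∃ λ m → Q m × (∀ k → k < m → ¬ Q k))
  search zero = inj₁ (λ k ())
  search (suc i) with search i
  ... | inj₂ found = inj₂ found
  ... | inj₁ none with Q? i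
  ...   | yes Qi = inj₂ (i , Qi , none)
  ...   | no ¬Qi = inj₁ λ k k<1+i → [ (λ k<i → none k k<i) , (λ { P.refl → ¬Qi }) ]′ (ℕP.m≤n⇒m<n∨m≡n (ℕP.≤-pred k<1+i))
... | inj₁ none  = ⊥-elim (none n (ℕP.n<1+n n) Qn)
... | inj₂ found = found

module MultiplicativeGroup {c ℓ : Level} (F : FiniteField c ℓ) where
  open FieldTheory F
  open PrimePowers

  power-cycle : ∀ {x} a b → x ≉ 0# → a < b → x ^ a ≈ x ^ b → x ^ (b ℕ.∸ a) ≈ 1#
  power-cycle {x} a b x≉0 a<b xᵃ≈xᵇ = sym (*-cancelˡ (^-nonzero a x≉0) (begin
    x ^ a * 1#                 ≈⟨ *-identityʳ _ ⟩
    x ^ a                      ≈⟨ xᵃ≈xᵇ ⟩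
    x ^ b                      ≡⟨ P.cong (x ^_) (P.sym (ℕP.m∸n+n≡m (ℕP.<⇒≤ a<b))) ⟩
    x ^ ((b ℕ.∸ a) ℕ.+ a)      ≈⟨ ^-homo-* x (b ℕ.∸ a) a ⟩
    x ^ (b ℕ.∸ a) * x ^ a      ≈⟨ *-comm _ _ ⟩
    x ^ a * x ^ (b ℕ.∸ a)      ∎))

  -- by the pigeonhole principle, some positive power of a nonzero x is 1
  power-one : ∀ x → x ≉ 0# → ∃ λ d → 0 < d × x ^ d ≈ 1#
  power-one x x≉0 with FinP.pigeonhole (ℕP.n<1+n size) (λ i → proj₁ (enum-surj (x ^ toℕ i)))
  ... | i , j , i<j , same = toℕ j ℕ.∸ toℕ i , ℕP.m<n⇒0<n∸m i<j , power-cycle (toℕ i) (toℕ j) x≉0 i<j (begin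
    x ^ toℕ i                                ≈⟨ sym (proj₂ (enum-surj (x ^ toℕ i))) ⟩
    enum (proj₁ (enum-surj (x ^ toℕ i)))     ≡⟨ P.cong enum same ⟩
    enum (proj₁ (enum-surj (x ^ toℕ j)))     ≈⟨ proj₂ (enum-surj (x ^ toℕ j)) ⟩
    x ^ toℕ j                                ∎)

  record IsOrder (x : Carrier) (e : ℕ) : Set ℓ where
    field
      positive    : 0 < e
      annihilates : x ^ e ≈ 1#
      minimal     : ∀ k → 0 < k → k < e → x ^ k ≉ 1#
  open IsOrder

  order : ∀ x → x ≉ 0# → ∃ λ e → IsOrder x e
  order x x≉0 with power-one x x≉0
  ... | d , 0<d , xᵈ≈1 with least (λ k → 0 < k × x ^ k ≈ 1#) Q? d (0<d , xᵈ≈1)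
    where
    Q? : Decidable (λ k → 0 < k × x ^ k ≈ 1#)
    Q? k with 0 ℕ.<? k | (x ^ k) ≟ 1#
    ... | yes p | yes q = yes (p , q)
    ... | no ¬p | _     = no (¬p ∘ proj₁)
    ... | yes _ | no ¬q = no (¬q ∘ proj₂)
  ... | e , (0<e , xᵉ≈1) , below = e , record
    { positive = 0<e ; annihilates = xᵉ≈1 ; minimal = λ k 0<k k<e xᵏ≈1 → below k k<e (0<k , xᵏ≈1) }

  divides-order : ∀ {x e N} → IsOrder x e → e ∣ N → x ^ N ≈ 1#
  divides-order {x} {e} o (divides q P.refl) = begin
    x ^ (q ℕ.* e)   ≡⟨ P.cong (x ^_) (ℕP.*-comm q e) ⟩
    x ^ (e ℕ.* q)   ≈⟨ sym (^-assocʳ x e q) ⟩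
    (x ^ e) ^ q     ≈⟨ ^-congˡ q (annihilates o) ⟩
    1# ^ q          ≈⟨ 1^n≈1 q ⟩
    1#              ∎

  order-divides : ∀ {x e N} → IsOrder x e → x ^ N ≈ 1# → e ∣ N
  order-divides {x} {e@(suc _)} {N} o xᴺ≈1 with N % e in N%e≡r
  ... | zero  = m%n≡0⇒n∣m N e N%e≡r
  ... | suc r = ⊥-elim (minimal o (suc r) (s≤s z≤n) (P.subst (_< e) N%e≡r (m%n<n N e)) xʳ⁺¹≈1)
    where
    x^[N/e*e]≈1 : x ^ (N / e ℕ.* e) ≈ 1#
    x^[N/e*e]≈1 = divides-order o (divides (N / e) P.refl)
    xʳ⁺¹≈1 : x ^ suc r ≈ 1#
    xʳ⁺¹≈1 = *-cancelˡ (λ z → 1≉0 (trans (sym x^[N/e*e]≈1) z)) (begin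
      x ^ (N / e ℕ.* e) * x ^ suc r          ≈⟨ *-comm _ _ ⟩
      x ^ suc r * x ^ (N / e ℕ.* e)          ≈⟨ sym (^-homo-* x (suc r) _) ⟩
      x ^ (suc r ℕ.+ N / e ℕ.* e)            ≡⟨ P.cong (λ z → x ^ (z ℕ.+ N / e ℕ.* e)) (P.sym N%e≡r) ⟩
      x ^ (N % e ℕ.+ N / e ℕ.* e)            ≡⟨ P.cong (x ^_) (P.sym (m≡m%n+[m/n]*n N e)) ⟩
      x ^ N                                  ≈⟨ xᴺ≈1 ⟩
      1#                                     ≈⟨ sym x^[N/e*e]≈1 ⟩
      x ^ (N / e ℕ.* e)                      ≈⟨ sym (*-identityʳ _) ⟩
      x ^ (N / e ℕ.* e) * 1#                 ∎)

  order-unique : ∀ {x e e′} → IsOrder x e → IsOrder x e′ → e ≡ e′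
  order-unique o o′ = ∣-antisym (order-divides o (annihilates o′)) (order-divides o′ (annihilates o))

  order-cong : ∀ {x y e} → x ≈ y → IsOrder x e → IsOrder y e
  order-cong {e = e} x≈y o = record
    { positive    = positive o
    ; annihilates = trans (^-congˡ e (sym x≈y)) (annihilates o)
    ; minimal     = λ k 0<k k<e yᵏ≈1 → minimal o k 0<k k<e (trans (^-congˡ k x≈y) yᵏ≈1)
    }

  order-^ : ∀ {x} u v → IsOrder x (u ℕ.* v) → 0 < u → IsOrder (x ^ u) v
  order-^ {x} u zero    o 0<u = ⊥-elim (ℕP.<⇒≱ (positive o) (ℕP.≤-reflexive (ℕP.*-zeroʳ u)))
  order-^ {x} u (suc v) o 0<u = record
    { positive    = s≤s z≤n
    ; annihilates = trans (^-assocʳ x u (suc v)) (annihilates o)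
    ; minimal     = λ k 0<k k<v xᵘᵏ≈1 → minimal o (u ℕ.* k) (ℕP.*-mono-≤ 0<u 0<k)
                      (ℕP.*-monoʳ-< u {{ℕ.>-nonZero 0<u}} k<v) (trans (sym (^-assocʳ x u k)) xᵘᵏ≈1)
    }

  cancel-factor : ∀ {x y t k} → IsOrder y t → (x * y) ^ k ≈ 1# → x ^ (k ℕ.* t) ≈ 1#
  cancel-factor {x} {y} {t} {k} oy xyᵏ≈1 = begin
    x ^ (k ℕ.* t)                    ≈⟨ sym (*-identityʳ _) ⟩
    x ^ (k ℕ.* t) * 1#               ≈⟨ *-congˡ (sym (divides-order oy (divides k P.refl))) ⟩
    x ^ (k ℕ.* t) * y ^ (k ℕ.* t)    ≈⟨ sym (^-distrib-* x y (k ℕ.* t)) ⟩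
    (x * y) ^ (k ℕ.* t)              ≈⟨ sym (^-assocʳ (x * y) k t) ⟩
    ((x * y) ^ k) ^ t                ≈⟨ ^-congˡ t xyᵏ≈1 ⟩
    1# ^ t                           ≈⟨ 1^n≈1 t ⟩
    1#                               ∎

  order-* : ∀ {x y r t} → IsOrder x r → IsOrder y t → Coprime r t → IsOrder (x * y) (r ℕ.* t)
  order-* {x} {y} {r} {t} ox oy r⊥t = record
    { positive    = ℕP.*-mono-≤ (positive ox) (positive oy)
    ; annihilates = power-of-product (r ℕ.* t) (divides t (ℕP.*-comm r t)) (divides r P.refl)
    ; minimal     = λ k 0<k k<rt xyᵏ≈1 → ℕP.<⇒≱ k<rt (∣⇒≤ {{ℕ.>-nonZero 0<k}} (rt∣ k xyᵏ≈1))
    }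
    where
    power-of-product : ∀ N → r ∣ N → t ∣ N → (x * y) ^ N ≈ 1#
    power-of-product N r∣N t∣N = begin
      (x * y) ^ N     ≈⟨ ^-distrib-* x y N ⟩
      x ^ N * y ^ N   ≈⟨ *-cong (divides-order ox r∣N) (divides-order oy t∣N) ⟩
      1# * 1#         ≈⟨ *-identityˡ 1# ⟩
      1#              ∎
    rt∣ : ∀ k → (x * y) ^ k ≈ 1# → r ℕ.* t ∣ k
    rt∣ k xyᵏ≈1 = coprime-product-∣ r⊥t (order-divides ox (cancel-factor {x} {k = k} oy xyᵏ≈1))
                    (order-divides oy (cancel-factor {y} {k = k} ox (trans (^-congˡ k (*-comm y x)) xyᵏ≈1)))

  order-one : IsOrder 1# 1
  order-one = record
    { positive = s≤s z≤n ; annihilates = *-identityʳ 1#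
    ; minimal = λ { k 0<k (s≤s k≤0) _ → ℕP.<⇒≱ 0<k k≤0 } }

  record MaximalOrder : Set (c ⊔ ℓ) where
    field
      a       : Carrier
      e       : ℕ
      a≉0     : a ≉ 0#
      a-order : IsOrder a e
      maximal : ∀ y → y ≉ 0# → ∀ s → IsOrder y s → s ≤ e

  maximum : ∀ m (f : Fin m → Carrier) → ∃₂ λ a e → a ≉ 0# × IsOrder a e ×
              (∀ i → f i ≉ 0# → ∀ s → IsOrder (f i) s → s ≤ e)
  maximum zero    f = 1# , 1 , 1≉0 , order-one , λ ()
  maximum (suc m) f with maximum m (f ∘ Fin.suc) | ≈-dec (f Fin.zero) 0#
  ... | a , e , a≉0 , oa , max | inj₁ f₀≈0 = a , e , a≉0 , oa , λ
    { Fin.zero f₀≉0 → ⊥-elim (f₀≉0 f₀≈0) ; (Fin.suc i) → max i }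
  ... | a , e , a≉0 , oa , max | inj₂ f₀≉0 with order (f Fin.zero) f₀≉0
  ... | s₀ , o₀ with s₀ ℕ.≤? e
  ... | yes s₀≤e = a , e , a≉0 , oa , λ
    { Fin.zero _ s o → P.subst (_≤ e) (order-unique o₀ o) s₀≤e ; (Fin.suc i) → max i }
  ... | no s₀≰e = f Fin.zero , s₀ , f₀≉0 , o₀ , λ
    { Fin.zero _ s o → ℕP.≤-reflexive (order-unique o o₀)
    ; (Fin.suc i) y≉0 s o → ℕP.≤-trans (max i y≉0 s o) (ℕP.<⇒≤ (ℕP.≰⇒> s₀≰e)) }

  maximalOrder : MaximalOrder
  maximalOrder with maximum size enum
  ... | a , e , a≉0 , oa , max = record
    { a = a ; e = e ; a≉0 = a≉0 ; a-order = oa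
    ; maximal = λ y y≉0 s o → let (i , eᵢ≈y) = enum-surj y in
        max i (λ z → y≉0 (trans (sym eᵢ≈y) z)) s (order-cong (sym eᵢ≈y) o) }

  -- Polynomials as coefficient vectors, lowest degree first.
  eval : ∀ {L} → Vec Carrier L → Carrier → Carrier
  eval []       x = 0#
  eval (c ∷ cs) x = c + x * eval cs x

  quotient : ∀ {L} → Carrier → Vec Carrier (suc L) → Vec Carrier L
  quotient r (c ∷ [])     = []
  quotient r (c ∷ c' ∷ cs) = eval (c' ∷ cs) r ∷ quotient r (c' ∷ cs)

  division : ∀ {L} r (f : Vec Carrier (suc L)) x → eval f x ≈ (x - r) * eval (quotient r f) x + eval f r
  division r (c ∷ []) x =
    solve 3 (λ r c x → c :+ x :* con (+ 0) := (x :- r) :* con (+ 0) :+ (c :+ r :* con (+ 0))) refl r c x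
  division r (c ∷ c' ∷ cs) x = begin
    c + x * eval (c' ∷ cs) x     ≈⟨ +-congˡ (*-congˡ (division r (c' ∷ cs) x)) ⟩
    c + x * ((x - r) * Q + C)    ≈⟨ solve 5 (λ c x r Q C → c :+ x :* ((x :- r) :* Q :+ C)
                                      := (x :- r) :* (C :+ x :* Q) :+ (c :+ r :* C)) refl c x r Q C ⟩
    (x - r) * (C + x * Q) + (c + r * C) ∎
    where
    Q = eval (quotient r (c' ∷ cs)) x
    C = eval (c' ∷ cs) r

  Distinct : ∀ {L} → Vec Carrier L → Set ℓ
  Distinct {L} rs = ∀ (i j : Fin L) → i ≢ j → lookup rs i ≉ lookup rs j

  x≉y⇒x-y≉0 : ∀ {x y} → x ≉ y → x - y ≉ 0#
  x≉y⇒x-y≉0 {x} {y} x≉y x-y≈0 = x≉y (begin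
    x            ≈⟨ solve 2 (λ x y → x := (x :- y) :+ y) refl x y ⟩
    (x - y) + y  ≈⟨ +-congʳ x-y≈0 ⟩
    0# + y       ≈⟨ +-identityˡ y ⟩
    y            ∎)

  vanishing : ∀ {L} (f rs : Vec Carrier L) → Distinct rs → (∀ i → eval f (lookup rs i) ≈ 0#) → ∀ x → eval f x ≈ 0#
  vanishing []      []       _        _     x = refl
  vanishing f@(_ ∷ _) (r ∷ rs) distinct roots x = begin
    eval f x                                  ≈⟨ division r f x ⟩
    (x - r) * eval (quotient r f) x + eval f r ≈⟨ +-cong (*-congˡ (vanishing (quotient r f) rs distinct′ roots′ x)) (roots Fin.zero) ⟩
    (x - r) * 0# + 0#                          ≈⟨ solve 2 (λ x r → (x :- r) :* con (+ 0) :+ con (+ 0) := con (+ 0)) refl x r ⟩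
    0#                                         ∎
    where
    distinct′ : Distinct rs
    distinct′ i j i≢j = distinct (Fin.suc i) (Fin.suc j) (i≢j ∘ FinP.suc-injective)
    -- the quotient vanishes at the remaining points, since they differ from r
    roots′ : ∀ i → eval (quotient r f) (lookup rs i) ≈ 0#
    roots′ i = zero-product (x≉y⇒x-y≉0 (distinct (Fin.suc i) Fin.zero (λ ()))) (begin
      (rᵢ - r) * eval (quotient r f) rᵢ            ≈⟨ sym (+-identityʳ _) ⟩
      (rᵢ - r) * eval (quotient r f) rᵢ + 0#       ≈⟨ +-congˡ (sym (roots Fin.zero)) ⟩
      (rᵢ - r) * eval (quotient r f) rᵢ + eval f r ≈⟨ sym (division r f rᵢ) ⟩
      eval f rᵢ                                    ≈⟨ roots (Fin.suc i) ⟩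
      0#                                           ∎)
      where rᵢ = lookup rs i

  monomial : ∀ n → Vec Carrier (suc n)
  monomial zero    = 1# ∷ []
  monomial (suc n) = 0# ∷ monomial n

  eval-monomial : ∀ n x → eval (monomial n) x ≈ x ^ n
  eval-monomial zero    x = solve 1 (λ x → con (+ 1) :+ x :* con (+ 0) := con (+ 1)) refl x
  eval-monomial (suc n) x = trans (+-identityˡ _) (*-congˡ (eval-monomial n x))

  xⁿ-1 : ∀ n → Vec Carrier (suc n)
  xⁿ-1 zero    = 0# ∷ []
  xⁿ-1 (suc n) = - 1# ∷ monomial n

  eval-xⁿ-1 : ∀ n x → eval (xⁿ-1 n) x ≈ x ^ n - 1#
  eval-xⁿ-1 zero    x = solve 1 (λ x → con (+ 0) :+ x :* con (+ 0) := con (+ 1) :- con (+ 1)) refl x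
  eval-xⁿ-1 (suc n) x = trans (+-congˡ (*-congˡ (eval-monomial n x))) (+-comm (- 1#) (x * x ^ n))

  0^n≈0 : ∀ {n} → 0 < n → 0# ^ n ≈ 0#
  0^n≈0 {suc n} _ = zeroˡ _

  -- An element a of maximal order e generates F*: every nonzero y satisfies
  -- y ^ e = 1, so the e distinct powers of a and y are roots of x ^ e - 1;
  -- a polynomial of degree e has at most e roots, so y is a power of a.
  module Generator (m : MaximalOrder) where
    open MaximalOrder m

    -- The maximal order e is an exponent of F*: if some y had order s ∤ e,
    -- a prime p would divide s to a power p ^ k higher than the power p ^ j
    -- in e = p ^ j e'; then y ^ s' * a ^ (p ^ j) has order p ^ k e' > e.
    annihilates-all : ∀ y → y ≉ 0# → y ^ e ≈ 1#
    annihilates-all y y≉0 with (y ^ e) ≟ 1#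
    ... | yes yᵉ≈1 = yᵉ≈1
    ... | no yᵉ≉1 with order y y≉0
    ... | s , os with excessPrime s e (positive os) (positive a-order) (yᵉ≉1 ∘ divides-order os)
    ... | p , k , j , s' , e' , p-prime , s≡s'pᵏ , e≡pʲe' , p∤e' , j<k =
        ⊥-elim (ℕP.<⇒≱ e<pᵏe' (maximal _ (*-nonzero (^-nonzero s' y≉0) (^-nonzero (p ℕ.^ j) a≉0)) _ order-of-product))
      where
      instance _ = prime⇒nonZero p-prime
      positive-factor : ∀ u v → 0 < u ℕ.* v → 0 < u
      positive-factor (suc _) _ _ = s≤s z≤n
      order-of-product : IsOrder (y ^ s' * a ^ (p ℕ.^ j)) (p ℕ.^ k ℕ.* e')
      order-of-product = order-* (order-^ s' (p ℕ.^ k) (P.subst (IsOrder y) s≡s'pᵏ os)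
                                    (positive-factor s' (p ℕ.^ k) (P.subst (0 <_) s≡s'pᵏ (positive os))))
                                 (order-^ (p ℕ.^ j) e' (P.subst (IsOrder a) e≡pʲe' a-order) (ℕP.m^n>0 p j))
                                 (coprime-^ (prime∤⇒coprime p-prime p∤e') k)
      e<pᵏe' : e < p ℕ.^ k ℕ.* e'
      e<pᵏe' = P.subst (_< p ℕ.^ k ℕ.* e') (P.sym e≡pʲe')
        (ℕP.*-monoˡ-< e' {{ℕ.>-nonZero (positive-factor e' (p ℕ.^ j)
           (P.subst (0 <_) (P.trans e≡pʲe' (ℕP.*-comm (p ℕ.^ j) e')) (positive a-order)))}}
          (ℕP.^-monoʳ-< p (prime>1 p-prime) j<k))

    powers-distinct : ∀ (i j : Fin e) → i ≢ j → a ^ toℕ i ≉ a ^ toℕ j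
    powers-distinct i j i≢j aⁱ≈aʲ with ℕP.<-cmp (toℕ i) (toℕ j)
    ... | tri< i<j _ _ = minimal a-order (toℕ j ℕ.∸ toℕ i) (ℕP.m<n⇒0<n∸m i<j)
          (ℕP.≤-trans (s≤s (ℕP.m∸n≤m (toℕ j) (toℕ i))) (FinP.toℕ<n j)) (power-cycle (toℕ i) (toℕ j) a≉0 i<j aⁱ≈aʲ)
    ... | tri≈ _ i≡j _ = i≢j (FinP.toℕ-injective i≡j)
    ... | tri> _ _ j<i = minimal a-order (toℕ i ℕ.∸ toℕ j) (ℕP.m<n⇒0<n∸m j<i)
          (ℕP.≤-trans (s≤s (ℕP.m∸n≤m (toℕ i) (toℕ j))) (FinP.toℕ<n i)) (power-cycle (toℕ j) (toℕ i) a≉0 j<i (sym aⁱ≈aʲ))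

    not-a-power : ∀ y → y ≉ 0# → ¬ (∃ λ (i : Fin e) → a ^ toℕ i ≈ y) → ⊥
    not-a-power y y≉0 not-power = -1≉0 (begin
      - 1#                   ≈⟨ solve 0 (:- con (+ 1) := con (+ 0) :- con (+ 1)) refl ⟩
      0# - 1#                ≈⟨ +-congʳ (sym (0^n≈0 (positive a-order))) ⟩
      0# ^ e - 1#            ≈⟨ sym (eval-xⁿ-1 e 0#) ⟩
      eval (xⁿ-1 e) 0#       ≈⟨ vanishing (xⁿ-1 e) roots distinct is-root 0# ⟩
      0#                     ∎)
      where
      roots : Vec Carrier (suc e)
      roots = y ∷ tabulate (λ (i : Fin e) → a ^ toℕ i)
      lookup-power : ∀ i → lookup roots (Fin.suc i) ≡ a ^ toℕ i
      lookup-power = VecP.lookup∘tabulate (λ (i : Fin e) → a ^ toℕ i)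
      distinct : Distinct roots
      distinct Fin.zero    Fin.zero    0≢0 _ = 0≢0 P.refl
      distinct Fin.zero    (Fin.suc j) _ y≈aʲ = not-power (j , trans (reflexive (P.sym (lookup-power j))) (sym y≈aʲ))
      distinct (Fin.suc i) Fin.zero    _ aⁱ≈y = not-power (i , trans (reflexive (P.sym (lookup-power i))) aⁱ≈y)
      distinct (Fin.suc i) (Fin.suc j) i≢j aⁱ≈aʲ = powers-distinct i j (i≢j ∘ P.cong Fin.suc)
        (trans (reflexive (P.sym (lookup-power i))) (trans aⁱ≈aʲ (reflexive (lookup-power j))))
      root : ∀ z → z ≉ 0# → eval (xⁿ-1 e) z ≈ 0#
      root z z≉0 = trans (eval-xⁿ-1 e z) (trans (+-congʳ (annihilates-all z z≉0)) (-‿inverseʳ 1#))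
      is-root : ∀ i → eval (xⁿ-1 e) (lookup roots i) ≈ 0#
      is-root Fin.zero    = root y y≉0
      is-root (Fin.suc i) = trans (reflexive (P.cong (eval (xⁿ-1 e)) (lookup-power i))) (root _ (^-nonzero (toℕ i) a≉0))

    generates : ∀ y → y ≉ 0# → ∃ λ k → a ^ k ≈ y
    generates y y≉0 with FinP.any? (λ (i : Fin e) → (a ^ toℕ i) ≟ y)
    ... | yes (i , aⁱ≈y) = toℕ i , aⁱ≈y
    ... | no  not-power  = ⊥-elim (not-a-power y y≉0 not-power)

  primitiveElement : ∃ λ g → g ≉ 0# × (∀ y → y ≉ 0# → ∃ λ k → g ^ k ≈ y)
  primitiveElement = MaximalOrder.a maximalOrder , MaximalOrder.a≉0 maximalOrder , Generator.generates maximalOrder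

vec₂ : ∀ {a} {A : Set a} → A → A → Fin 2 → A
vec₂ u v zero       = u
vec₂ u v (suc zero) = v

vec₃ : ∀ {a} {A : Set a} → A → A → A → Fin 3 → A
vec₃ u v w zero             = u
vec₃ u v w (suc zero)       = v
vec₃ u v w (suc (suc zero)) = w

fin1-unique : ∀ {s t : Fin 1} → s ≡ t
fin1-unique {zero} {zero} = P.refl

vec₂-injective : ∀ {a} {A : Set a} {p q : A} → p ≢ q → ∀ {s t} → vec₂ p q s ≡ vec₂ p q t → s ≡ t
vec₂-injective p≢q {zero}     {zero}     _   = P.refl
vec₂-injective p≢q {zero}     {suc zero} p≡q = ⊥-elim (p≢q p≡q)
vec₂-injective p≢q {suc zero} {zero}     q≡p = ⊥-elim (p≢q (P.sym q≡p))
vec₂-injective p≢q {suc zero} {suc zero} _   = P.refl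

vec₃-injective : ∀ {a} {A : Set a} {r m c : A} → r ≢ m → m ≢ c → r ≢ c → ∀ {s t} → vec₃ r m c s ≡ vec₃ r m c t → s ≡ t
vec₃-injective r≢m m≢c r≢c {zero}           {zero}           _ = P.refl
vec₃-injective r≢m m≢c r≢c {zero}           {suc zero}       e = ⊥-elim (r≢m e)
vec₃-injective r≢m m≢c r≢c {zero}           {suc (suc zero)} e = ⊥-elim (r≢c e)
vec₃-injective r≢m m≢c r≢c {suc zero}       {zero}           e = ⊥-elim (r≢m (P.sym e))
vec₃-injective r≢m m≢c r≢c {suc zero}       {suc zero}       _ = P.refl
vec₃-injective r≢m m≢c r≢c {suc zero}       {suc (suc zero)} e = ⊥-elim (m≢c e)
vec₃-injective r≢m m≢c r≢c {suc (suc zero)} {zero}           e = ⊥-elim (r≢c (P.sym e))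
vec₃-injective r≢m m≢c r≢c {suc (suc zero)} {suc zero}       e = ⊥-elim (m≢c (P.sym e))
vec₃-injective r≢m m≢c r≢c {suc (suc zero)} {suc (suc zero)} _ = P.refl

-- They are later interpreted
-- both in the field F and in the ring of integer polynomials, so that a
-- relation between products of elementary matrices can be checked
-- symbolically by the ring solver.
module RowAction {a ℓ} (R : RawRing a ℓ) where
  open RawRing R

  rowOp : ∀ {m} → Fin m → Fin m → Carrier → Carrier → (Fin m → Carrier) → Fin m → Carrier
  rowOp r c α β w x = if does (x Fin.≟ r) then α * w r + β * w c else w x

  rowOp-target : ∀ {m} (r c : Fin m) α β w → rowOp r c α β w r ≡ α * w r + β * w c
  rowOp-target r c α β w with r Fin.≟ r
  ... | yes _  = P.refl
  ... | no r≢r = ⊥-elim (r≢r P.refl)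

  rowOp-other : ∀ {m} {x r : Fin m} → x ≢ r → ∀ c α β w → rowOp r c α β w x ≡ w x
  rowOp-other {x = x} {r} x≢r c α β w with x Fin.≟ r
  ... | yes x≡r = ⊥-elim (x≢r x≡r)
  ... | no _    = P.refl

  record Step (m : ℕ) : Set a where
    constructor op
    field
      target source : Fin m
      α β           : Carrier

  -- a word of row operations acts on column vectors, its last letter first
  act : ∀ {m} → List (Step m) → (Fin m → Carrier) → Fin m → Carrier
  act []                w = w
  act (op r c α β ∷ ss) w = rowOp r c α β (act ss w)

  Relation : ℕ → Set a
  Relation m = List (Step m) × List (Step m)

  infix 4 _≐_
  _≐_ : ∀ {m} → List (Step m) → List (Step m) → Relation m
  ls ≐ rs = ls , rs

module RelationWords {a ℓ} (R : RawRing a ℓ) where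
  open RawRing R
  open RowAction R

  tr : ∀ {m} → Fin m → Fin m → Carrier → Step m
  tr r c b = op r c 1# b

  dil : ∀ {m} → Fin m → Carrier → Step m
  dil r μ = op r r μ 0#

  p q : Fin 2
  p = # 0
  q = # 1

  compose : Carrier → Carrier → Carrier → Carrier → Relation 2
  compose α β α′ β′ = (op p q α β ∷ op p q α′ β′ ∷ []) ≐ (op p q (α * α′) (α * β′ + β) ∷ [])

  transvection-inverse : Carrier → Relation 2
  transvection-inverse b = (tr p q b ∷ tr p q (- b) ∷ []) ≐ []

  -- the transposed transvection tr q p 1 from x = tr p q 1 and
  -- y = (row q := g·row q + row p):  tr q p 1 · y x⁻¹ y = y x⁻¹ y x⁻¹
  transposed : Carrier → Relation 2
  transposed g = (tr q p 1# ∷ y ∷ tr p q (- 1#) ∷ y ∷ []) ≐ (y ∷ tr p q (- 1#) ∷ y ∷ tr p q (- 1#) ∷ [])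
    where y = op q p g 1#

  dilation-from : Carrier → Relation 2
  dilation-from g = (dil q g ∷ []) ≐ (tr q p (- 1#) ∷ op q p g 1# ∷ [])

  scale-source : Carrier → Relation 2
  scale-source μ = (dil q μ ∷ tr p q μ ∷ []) ≐ (tr p q 1# ∷ dil q μ ∷ [])

  scale-target : Carrier → Relation 2
  scale-target μ = (tr p q μ ∷ dil p μ ∷ []) ≐ (dil p μ ∷ tr p q 1# ∷ [])

  -- w = tr p q 1 · tr q p (-1) · tr p q 1 maps row q to row p: w dil q μ = dil p μ w
  swap-dilation : Carrier → Relation 2
  swap-dilation μ = (dil p μ ∷ w) ≐ (tr p q 1# ∷ tr q p (- 1#) ∷ tr p q 1# ∷ dil q μ ∷ [])
    where w = tr p q 1# ∷ tr q p (- 1#) ∷ tr p q 1# ∷ []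

  dilation-compose : Carrier → Carrier → Relation 1
  dilation-compose μ ν = (dil (# 0) (μ * ν) ∷ []) ≐ (dil (# 0) μ ∷ dil (# 0) ν ∷ [])

  commutator : Carrier → Carrier → Relation 3
  commutator a b = (tr (# 0) (# 2) (a * b) ∷ tr (# 1) (# 2) b ∷ tr (# 0) (# 1) a ∷ [])
                 ≐ (tr (# 0) (# 1) a ∷ tr (# 1) (# 2) b ∷ [])

-- This is checked by the ring solver, evaluating the words
-- in the ring of integer polynomials on symbolic coefficients and entries.
module RelationsInField {c ℓ : Level} (F : FiniteField c ℓ) where
  open FieldTheory F
  open RowAction (CommutativeRing.rawRing commRing) public
  open RelationWords (CommutativeRing.rawRing commRing) public

  Holds : ∀ {k} → Relation k → Set (c ⊔ ℓ)
  Holds rel = ∀ w t → act (proj₁ rel) w t ≈ act (proj₂ rel) w t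

  Symbolic : ℕ → RawRing _ _
  Symbolic k = record
    { Carrier = Polynomial k ; _≈_ = _≡_ ; _+_ = _:+_ ; _*_ = _:*_ ; -_ = :-_
    ; 0# = con (+ 0) ; 1# = con (+ 1) }

  module 𝒮 (k : ℕ) = RelationWords (Symbolic k)

  actₛ : ∀ {k m} → List (RowAction.Step (Symbolic k) m) → (Fin m → Polynomial k) → Fin m → Polynomial k
  actₛ {k} = RowAction.act (Symbolic k)

  row-equation : ∀ {k m} → RowAction.Relation (Symbolic k) m → (Fin m → Polynomial k) → Fin m → Polynomial k × Polynomial k
  row-equation rel w t = actₛ (proj₁ rel) w t := actₛ (proj₂ rel) w t

  compose-holds : ∀ α β α′ β′ → Holds (compose α β α′ β′)
  compose-holds α β α′ β′ w zero = solve 6 (λ α β α′ β′ u v →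
    row-equation (𝒮.compose 6 α β α′ β′) (vec₂ u v) (# 0)) refl α β α′ β′ (w (# 0)) (w (# 1))
  compose-holds α β α′ β′ w (suc zero) = solve 6 (λ α β α′ β′ u v →
    row-equation (𝒮.compose 6 α β α′ β′) (vec₂ u v) (# 1)) refl α β α′ β′ (w (# 0)) (w (# 1))

  transvection-inverse-holds : ∀ b → Holds (transvection-inverse b)
  transvection-inverse-holds b w zero = solve 3 (λ b u v →
    row-equation (𝒮.transvection-inverse 3 b) (vec₂ u v) (# 0)) refl b (w (# 0)) (w (# 1))
  transvection-inverse-holds b w (suc zero) = refl

  transposed-holds : ∀ g → Holds (transposed g)
  transposed-holds g w zero = solve 3 (λ g u v →
    row-equation (𝒮.transposed 3 g) (vec₂ u v) (# 0)) refl g (w (# 0)) (w (# 1))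
  transposed-holds g w (suc zero) = solve 3 (λ g u v →
    row-equation (𝒮.transposed 3 g) (vec₂ u v) (# 1)) refl g (w (# 0)) (w (# 1))

  dilation-from-holds : ∀ g → Holds (dilation-from g)
  dilation-from-holds g w zero = refl
  dilation-from-holds g w (suc zero) = solve 3 (λ g u v →
    row-equation (𝒮.dilation-from 3 g) (vec₂ u v) (# 1)) refl g (w (# 0)) (w (# 1))

  scale-source-holds : ∀ μ → Holds (scale-source μ)
  scale-source-holds μ w zero = solve 3 (λ μ u v →
    row-equation (𝒮.scale-source 3 μ) (vec₂ u v) (# 0)) refl μ (w (# 0)) (w (# 1))
  scale-source-holds μ w (suc zero) = refl

  scale-target-holds : ∀ μ → Holds (scale-target μ)
  scale-target-holds μ w zero = solve 3 (λ μ u v →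
    row-equation (𝒮.scale-target 3 μ) (vec₂ u v) (# 0)) refl μ (w (# 0)) (w (# 1))
  scale-target-holds μ w (suc zero) = refl

  swap-dilation-holds : ∀ μ → Holds (swap-dilation μ)
  swap-dilation-holds μ w zero = solve 3 (λ μ u v →
    row-equation (𝒮.swap-dilation 3 μ) (vec₂ u v) (# 0)) refl μ (w (# 0)) (w (# 1))
  swap-dilation-holds μ w (suc zero) = solve 3 (λ μ u v →
    row-equation (𝒮.swap-dilation 3 μ) (vec₂ u v) (# 1)) refl μ (w (# 0)) (w (# 1))

  dilation-compose-holds : ∀ μ ν → Holds (dilation-compose μ ν)
  dilation-compose-holds μ ν w zero = solve 3 (λ μ ν u →
    row-equation (𝒮.dilation-compose 3 μ ν) (λ _ → u) (# 0)) refl μ ν (w (# 0))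

  commutator-holds : ∀ a b → Holds (commutator a b)
  commutator-holds a b w zero = solve 5 (λ a b u v x →
    row-equation (𝒮.commutator 5 a b) (vec₃ u v x) (# 0)) refl a b (w (# 0)) (w (# 1)) (w (# 2))
  commutator-holds a b w (suc zero) = solve 5 (λ a b u v x →
    row-equation (𝒮.commutator 5 a b) (vec₃ u v x) (# 1)) refl a b (w (# 0)) (w (# 1)) (w (# 2))
  commutator-holds a b w (suc (suc zero)) = refl

module MatrixAlgebra {c ℓ : Level} (F : FiniteField c ℓ) (n : ℕ) where
  open FieldTheory F
  open Matrices F n public
  open import Algebra.Properties.Semiring.Sum (CommutativeRing.semiring commRing)
    using (sum; sum-cong-≋; ∑-distrib-+; ∑-comm; *-distribˡ-sum; *-distribʳ-sum; sum-replicate-zero)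

  -- the sum ∑ of Defs is the library's sum, so its laws transfer
  ∑≈sum : ∀ {m} (f : Fin m → Carrier) → ∑ f ≈ sum f
  ∑≈sum {zero}  f = refl
  ∑≈sum {suc m} f = +-congˡ (∑≈sum (f ∘ suc))

  ∑-cong : ∀ {m} {f g : Fin m → Carrier} → (∀ k → f k ≈ g k) → ∑ f ≈ ∑ g
  ∑-cong {f = f} {g} f≈g = trans (∑≈sum f) (trans (sum-cong-≋ f≈g) (sym (∑≈sum g)))

  ∑-+ : ∀ {m} (f g : Fin m → Carrier) → ∑ (λ k → f k + g k) ≈ ∑ f + ∑ g
  ∑-+ {m} f g = trans (∑≈sum {m} _) (trans (∑-distrib-+ f g) (sym (+-cong (∑≈sum f) (∑≈sum g))))

  ∑-*ˡ : ∀ {m} a (f : Fin m → Carrier) → ∑ (λ k → a * f k) ≈ a * ∑ f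
  ∑-*ˡ {m} a f = trans (∑≈sum {m} _) (trans (sym (*-distribˡ-sum a f)) (*-congˡ (sym (∑≈sum f))))

  ∑-*ʳ : ∀ {m} a (f : Fin m → Carrier) → ∑ (λ k → f k * a) ≈ ∑ f * a
  ∑-*ʳ {m} a f = trans (∑≈sum {m} _) (trans (sym (*-distribʳ-sum a f)) (*-congʳ (sym (∑≈sum f))))

  ∑-0 : ∀ {m} (f : Fin m → Carrier) → (∀ k → f k ≈ 0#) → ∑ f ≈ 0#
  ∑-0 {m} f f≈0 = trans (∑-cong f≈0) (trans (∑≈sum {m} _) (sum-replicate-zero m))

  ∑-swap : ∀ {m₁ m₂} (f : Fin m₁ → Fin m₂ → Carrier) → ∑ (λ i → ∑ (λ j → f i j)) ≈ ∑ (λ j → ∑ (λ i → f i j))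
  ∑-swap {m₁} {m₂} f = begin
    ∑ (λ i → ∑ (λ j → f i j))      ≈⟨ trans (∑-cong (λ i → ∑≈sum (f i))) (∑≈sum {m₁} _) ⟩
    sum (λ i → sum (λ j → f i j))  ≈⟨ ∑-comm f ⟩
    sum (λ j → sum (λ i → f i j))  ≈⟨ sym (trans (∑-cong (λ j → ∑≈sum (λ i → f i j))) (∑≈sum {m₂} _)) ⟩
    ∑ (λ j → ∑ (λ i → f i j))      ∎

  I-diag : ∀ x → I x x ≈ 1#
  I-diag x with x Fin.≟ x
  ... | yes _  = refl
  ... | no x≢x = ⊥-elim (x≢x P.refl)

  I-off : ∀ {x y} → x ≢ y → I x y ≈ 0#
  I-off {x} {y} x≢y with x Fin.≟ y
  ... | yes x≡y = ⊥-elim (x≢y x≡y)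
  ... | no _    = refl

  I-sym : ∀ x y → I x y ≈ I y x
  I-sym x y with x Fin.≟ y | y Fin.≟ x
  ... | yes _   | yes _   = refl
  ... | no _    | no _    = refl
  ... | yes x≡y | no y≢x  = ⊥-elim (y≢x (P.sym x≡y))
  ... | no x≢y  | yes y≡x = ⊥-elim (x≢y (P.sym y≡x))

  δ : ∀ {m} → Fin m → Fin m → Carrier
  δ i j = if does (i Fin.≟ j) then 1# else 0#

  ∑-δ : ∀ {m} (r : Fin m) (f : Fin m → Carrier) → ∑ (λ k → δ r k * f k) ≈ f r
  ∑-δ {suc m} zero f = begin
    1# * f zero + ∑ (λ k → 0# * f (suc k))  ≈⟨ +-cong (*-identityˡ _) (∑-0 {m} _ (λ k → zeroˡ _)) ⟩
    f zero + 0#                             ≈⟨ +-identityʳ _ ⟩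
    f zero                                  ∎
  ∑-δ (suc r) f = begin
    0# * f zero + ∑ (λ k → δ r k * f (suc k)) ≈⟨ +-cong (zeroˡ _) (∑-δ r (f ∘ suc)) ⟩
    0# + f (suc r)                            ≈⟨ +-identityˡ _ ⟩
    f (suc r)                                 ∎

  ∑-δʳ : ∀ (r : Fin n) (f : Fin n → Carrier) → ∑ (λ k → f k * I k r) ≈ f r
  ∑-δʳ r f = trans (∑-cong {n} (λ k → trans (*-comm _ _) (*-congʳ (I-sym k r)))) (∑-δ r f)

  ⊗-cong : ∀ {A A′ B B′} → A ≈M A′ → B ≈M B′ → (A ⊗ B) ≈M (A′ ⊗ B′)
  ⊗-cong A≈A′ B≈B′ i j = ∑-cong {n} (λ k → *-cong (A≈A′ i k) (B≈B′ k j))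

  ⊗-assoc : ∀ A B C → ((A ⊗ B) ⊗ C) ≈M (A ⊗ (B ⊗ C))
  ⊗-assoc A B C i j = begin
    ∑ (λ k → ∑ (λ l → A i l * B l k) * C k j)  ≈⟨ ∑-cong {n} (λ k → sym (∑-*ʳ {n} (C k j) (λ l → A i l * B l k))) ⟩
    ∑ (λ k → ∑ (λ l → A i l * B l k * C k j))  ≈⟨ ∑-swap {n} {n} (λ k l → A i l * B l k * C k j) ⟩
    ∑ (λ l → ∑ (λ k → A i l * B l k * C k j))  ≈⟨ ∑-cong {n} (λ l → trans (∑-cong {n} (λ k → *-assoc _ _ _)) (∑-*ˡ {n} (A i l) _)) ⟩
    ∑ (λ l → A i l * ∑ (λ k → B l k * C k j))  ∎

  ⊗-identityˡ : ∀ A → (I ⊗ A) ≈M A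
  ⊗-identityˡ A i j = ∑-δ i (λ k → A k j)

  ⊗-identityʳ : ∀ A → (A ⊗ I) ≈M A
  ⊗-identityʳ A i j = ∑-δʳ j (A i)

  ≈M-refl : ∀ {A} → A ≈M A
  ≈M-refl i j = refl

  ≈M-sym : ∀ {A B} → A ≈M B → B ≈M A
  ≈M-sym A≈B i j = sym (A≈B i j)

  ≈M-trans : ∀ {A B C} → A ≈M B → B ≈M C → A ≈M C
  ≈M-trans A≈B B≈C i j = trans (A≈B i j) (B≈C i j)

module ElementaryMatrices {c ℓ : Level} (F : FiniteField c ℓ) (n : ℕ) where
  open FieldTheory F
  open MatrixAlgebra F n public
  open RelationsInField F public

  E : Fin n → Fin n → Carrier → Carrier → Mat
  E r c α β = S r (λ k → α * I r k + β * I c k)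

  T : Fin n → Fin n → Carrier → Mat
  T r c b = E r c 1# b

  D : Fin n → Carrier → Mat
  D r μ = E r r μ 0#

  column : Fin n → Mat → Fin n → Carrier
  column j A x = A x j

  rowOperation : Fin n → Fin n → Carrier → Carrier → Mat → Mat
  rowOperation r c α β A x j = rowOp r c α β (column j A) x

  E-act : ∀ r c α β A → (E r c α β ⊗ A) ≈M rowOperation r c α β A
  E-act r c α β A x j with x Fin.≟ r
  ... | no _      = ∑-δ x (λ k → A k j)
  ... | yes P.refl = begin
    ∑ (λ k → (α * I x k + β * I c k) * A k j)                      ≈⟨ ∑-cong {n} (λ k → distribʳ _ _ _) ⟩
    ∑ (λ k → α * I x k * A k j + β * I c k * A k j)                ≈⟨ ∑-+ {n} _ _ ⟩
    ∑ (λ k → α * I x k * A k j) + ∑ (λ k → β * I c k * A k j)      ≈⟨ +-cong (∑-cong {n} (λ k → *-assoc _ _ _)) (∑-cong {n} (λ k → *-assoc _ _ _)) ⟩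
    ∑ (λ k → α * (I x k * A k j)) + ∑ (λ k → β * (I c k * A k j))  ≈⟨ +-cong (∑-*ˡ {n} α _) (∑-*ˡ {n} β _) ⟩
    α * ∑ (λ k → I x k * A k j) + β * ∑ (λ k → I c k * A k j)      ≈⟨ +-cong (*-congˡ (∑-δ x (column j A))) (*-congˡ (∑-δ c (column j A))) ⟩
    α * A x j + β * A c j                                          ∎

  rowOp-cong : ∀ {m} (r c : Fin m) α β {w w′} → (∀ x → w x ≈ w′ x) → ∀ x → rowOp r c α β w x ≈ rowOp r c α β w′ x
  rowOp-cong r c α β w≈w′ x with x Fin.≟ r
  ... | yes _ = +-cong (*-congˡ (w≈w′ r)) (*-congˡ (w≈w′ c))
  ... | no _  = w≈w′ x

  E-cong : ∀ r c {α β α′ β′} → α ≈ α′ → β ≈ β′ → E r c α β ≈M E r c α′ β′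
  E-cong r c α≈α′ β≈β′ x j with x Fin.≟ r
  ... | yes _ = +-cong (*-congʳ α≈α′) (*-congʳ β≈β′)
  ... | no _  = refl

  module Tracked {k} (ρ : Fin k → Fin n) (ρ-injective : ∀ {s t} → ρ s ≡ ρ t → s ≡ t) where

    letter : Step k → Mat
    letter (op r c α β) = E (ρ r) (ρ c) α β

    word : List (Step k) → Mat
    word []       = I
    word (s ∷ ss) = letter s ⊗ word ss

    word-++ : ∀ ss ts → word (ss ++ ts) ≈M (word ss ⊗ word ts)
    word-++ []       ts = ≈M-sym (⊗-identityˡ (word ts))
    word-++ (s ∷ ss) ts = ≈M-trans (⊗-cong (≈M-refl {letter s}) (word-++ ss ts)) (≈M-sym (⊗-assoc (letter s) (word ss) (word ts)))

    rowOp-ρ : ∀ r c α β (w : Fin n → Carrier) t → rowOp (ρ r) (ρ c) α β w (ρ t) ≡ rowOp r c α β (w ∘ ρ) t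
    rowOp-ρ r c α β w t with t Fin.≟ r | ρ t Fin.≟ ρ r
    ... | yes _   | yes _     = P.refl
    ... | no _    | no _      = P.refl
    ... | yes t≡r | no ρt≢ρr  = ⊥-elim (ρt≢ρr (P.cong ρ t≡r))
    ... | no t≢r  | yes ρt≡ρr = ⊥-elim (t≢r (ρ-injective ρt≡ρr))

    word-tracked : ∀ ss t j → word ss (ρ t) j ≈ act ss (λ s → I (ρ s) j) t
    word-tracked []                t j = refl
    word-tracked (op r c α β ∷ ss) t j = begin
      (E (ρ r) (ρ c) α β ⊗ word ss) (ρ t) j            ≈⟨ E-act (ρ r) (ρ c) α β (word ss) (ρ t) j ⟩
      rowOp (ρ r) (ρ c) α β (column j (word ss)) (ρ t)  ≡⟨ rowOp-ρ r c α β (column j (word ss)) t ⟩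
      rowOp r c α β (column j (word ss) ∘ ρ) t          ≈⟨ rowOp-cong r c α β (λ s → word-tracked ss s j) t ⟩
      rowOp r c α β (act ss (λ s → I (ρ s) j)) t        ∎

    word-untracked : ∀ ss x → (∀ t → x ≢ ρ t) → ∀ j → word ss x j ≈ I x j
    word-untracked []                x x∉ρ j = refl
    word-untracked (op r c α β ∷ ss) x x∉ρ j = begin
      (E (ρ r) (ρ c) α β ⊗ word ss) x j            ≈⟨ E-act (ρ r) (ρ c) α β (word ss) x j ⟩
      rowOp (ρ r) (ρ c) α β (column j (word ss)) x  ≡⟨ rowOp-other (x∉ρ r) (ρ c) α β (column j (word ss)) ⟩
      word ss x j                                   ≈⟨ word-untracked ss x x∉ρ j ⟩
      I x j                                         ∎

    word-relation : ∀ (rel : Relation k) → Holds rel → word (proj₁ rel) ≈M word (proj₂ rel)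
    word-relation (ss , ts) holds x j with FinP.any? (λ t → x Fin.≟ ρ t)
    ... | yes (t , P.refl) = trans (word-tracked ss t j) (trans (holds _ t) (sym (word-tracked ts t j)))
    ... | no x∉ρ = trans (word-untracked ss x (λ t x≡ρt → x∉ρ (t , x≡ρt)) j)
                         (sym (word-untracked ts x (λ t x≡ρt → x∉ρ (t , x≡ρt)) j))

  E-row : ∀ r c α β k → E r c α β r k ≈ α * I r k + β * I c k
  E-row r c α β k with r Fin.≟ r
  ... | yes _  = refl
  ... | no r≢r = ⊥-elim (r≢r P.refl)

  E-other-row : ∀ {x r} → x ≢ r → ∀ c α β k → E r c α β x k ≈ I x k
  E-other-row {x} {r} x≢r c α β k with x Fin.≟ r
  ... | yes x≡r = ⊥-elim (x≢r x≡r)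
  ... | no _    = refl

  target-coefficient : ∀ {r c} → r ≢ c → ∀ α β → α * I r r + β * I c r ≈ α
  target-coefficient {r} {c} r≢c α β = begin
    α * I r r + β * I c r     ≈⟨ +-cong (*-congˡ (I-diag r)) (*-congˡ (I-off (r≢c ∘ P.sym))) ⟩
    α * 1# + β * 0#           ≈⟨ +-cong (*-identityʳ α) (zeroʳ β) ⟩
    α + 0#                    ≈⟨ +-identityʳ α ⟩
    α                         ∎

  E-source : ∀ {r c} → r ≢ c → ∀ α β → E r c α β r c ≈ β
  E-source {r} {c} r≢c α β = begin
    E r c α β r c             ≈⟨ E-row r c α β c ⟩
    α * I r c + β * I c c     ≈⟨ +-cong (*-congˡ (I-off r≢c)) (*-congˡ (I-diag c)) ⟩
    α * 0# + β * 1#           ≈⟨ +-cong (zeroʳ α) (*-identityʳ β) ⟩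
    0# + β                    ≈⟨ +-identityˡ β ⟩
    β                         ∎

  E-instruction : ∀ {r c} → r ≢ c → ∀ {α} β → α ≉ 0# → IsInstruction (E r c α β)
  E-instruction {r} {c} r≢c {α} β α≉0 =
    r , (λ k → α * I r k + β * I c k) , (λ vᵣ≈0 → α≉0 (trans (sym (target-coefficient r≢c α β)) vᵣ≈0)) , ≈M-refl

  E-identity : ∀ r c {α β} → α ≈ 1# → β ≈ 0# → E r c α β ≈M I
  E-identity r c {α} {β} α≈1 β≈0 x j with x Fin.≟ r
  ... | no _       = refl
  ... | yes P.refl = begin
    α * I x j + β * I c j   ≈⟨ +-cong (*-congʳ α≈1) (*-congʳ β≈0) ⟩
    1# * I x j + 0# * I c j ≈⟨ +-cong (*-identityˡ _) (zeroˡ _) ⟩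
    I x j + 0#              ≈⟨ +-identityʳ _ ⟩
    I x j                   ∎

  E-compose : ∀ {r c} → r ≢ c → ∀ α β α′ β′ → (E r c α β ⊗ E r c α′ β′) ≈M E r c (α * α′) (α * β′ + β)
  E-compose {r} {c} r≢c α β α′ β′ =
    ≈M-trans (⊗-cong (≈M-refl {E r c α β}) (≈M-sym (⊗-identityʳ _)))
      (≈M-trans (word-relation (compose α β α′ β′) (compose-holds α β α′ β′)) (⊗-identityʳ _))
    where open Tracked (vec₂ r c) (vec₂-injective r≢c)

  E-invertible : ∀ {r c} → r ≢ c → ∀ α β → α ≉ 0# → Invertible (E r c α β)
  E-invertible {r} {c} r≢c α β α≉0 = E r c α⁻¹ (- (α⁻¹ * β)) ,
    ≈M-trans (E-compose r≢c α β α⁻¹ (- (α⁻¹ * β))) (E-identity r c (⁻¹-inverseʳ α α≉0) right-zero) ,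
    ≈M-trans (E-compose r≢c α⁻¹ (- (α⁻¹ * β)) α β) (E-identity r c (⁻¹-inverseˡ α α≉0) left-zero)
    where
    α⁻¹ = α ⁻¹[ α≉0 ]
    right-zero : α * - (α⁻¹ * β) + β ≈ 0#
    right-zero = begin
      α * - (α⁻¹ * β) + β   ≈⟨ solve 3 (λ α α⁻¹ β → α :* (:- (α⁻¹ :* β)) :+ β := :- ((α :* α⁻¹) :* β) :+ β) refl α α⁻¹ β ⟩
      - ((α * α⁻¹) * β) + β ≈⟨ +-congʳ (-‿cong (*-congʳ (⁻¹-inverseʳ α α≉0))) ⟩
      - (1# * β) + β        ≈⟨ solve 1 (λ β → :- (con (+ 1) :* β) :+ β := con (+ 0)) refl β ⟩
      0#                    ∎
    left-zero : α⁻¹ * β + - (α⁻¹ * β) ≈ 0#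
    left-zero = -‿inverseʳ (α⁻¹ * β)

-- The subgroup ⟨ gs ⟩ generated by invertible matrices is closed under
-- inverses, so an unknown factor of a relation between members is a member.
module Subgroup {ℓ₁ ℓ₂ : Level} (F : FiniteField ℓ₁ ℓ₂) (n : ℕ) {k : ℕ}
  (gs : Fin k → Matrices.Mat F n) (gs-invertible : ∀ j → Matrices.Invertible F n (gs j)) where
  open FieldTheory F
  open ElementaryMatrices F n

  H : Mat → Set (ℓ₁ ⊔ ℓ₂)
  H = ⟨ gs ⟩

  H-inverse : ∀ {A} → H A → ∃ λ B → H B × (A ⊗ B) ≈M I × (B ⊗ A) ≈M I
  H-inverse (gen j) with gs-invertible j
  ... | B , AB≈I , BA≈I = B , inv (gen j) AB≈I BA≈I , AB≈I , BA≈I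
  H-inverse one = I , one , ⊗-identityˡ I , ⊗-identityˡ I
  H-inverse (mul {A} {B} hA hB) with H-inverse hA | H-inverse hB
  ... | A′ , hA′ , AA′≈I , A′A≈I | B′ , hB′ , BB′≈I , B′B≈I =
    B′ ⊗ A′ , mul hB′ hA′ , cancel-middle A B B′ A′ BB′≈I AA′≈I , cancel-middle B′ A′ A B A′A≈I B′B≈I
    where
    cancel-middle : ∀ X Y Y′ X′ → (Y ⊗ Y′) ≈M I → (X ⊗ X′) ≈M I → ((X ⊗ Y) ⊗ (Y′ ⊗ X′)) ≈M I
    cancel-middle X Y Y′ X′ YY′≈I XX′≈I =
      ≈M-trans (⊗-assoc X Y (Y′ ⊗ X′)) (≈M-trans (⊗-cong (≈M-refl {X}) (≈M-sym (⊗-assoc Y Y′ X′)))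
        (≈M-trans (⊗-cong (≈M-refl {X}) (⊗-cong YY′≈I (≈M-refl {X′})))
          (≈M-trans (⊗-cong (≈M-refl {X}) (⊗-identityˡ X′)) XX′≈I)))
  H-inverse (inv {A} {B} hA AB≈I BA≈I) = A , hA , BA≈I , AB≈I
  H-inverse (resp hA A≈B) with H-inverse hA
  ... | A′ , hA′ , AA′≈I , A′A≈I =
    A′ , hA′ , ≈M-trans (⊗-cong (≈M-sym A≈B) ≈M-refl) AA′≈I , ≈M-trans (⊗-cong ≈M-refl (≈M-sym A≈B)) A′A≈I

  cancelʳ : ∀ {Y W Z} → H Y → H W → (Z ⊗ Y) ≈M W → H Z
  cancelʳ {Y} {W} {Z} hY hW ZY≈W with H-inverse hY
  ... | Y′ , hY′ , YY′≈I , _ = resp (mul hW hY′) (≈M-sym Z≈WY′)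
    where
    Z≈WY′ : Z ≈M (W ⊗ Y′)
    Z≈WY′ = ≈M-trans (≈M-sym (⊗-identityʳ Z)) (≈M-trans (⊗-cong ≈M-refl (≈M-sym YY′≈I))
              (≈M-trans (≈M-sym (⊗-assoc Z Y Y′)) (⊗-cong ZY≈W ≈M-refl)))

  cancelˡ : ∀ {Y W Z} → H Y → H W → (Y ⊗ Z) ≈M W → H Z
  cancelˡ {Y} {W} {Z} hY hW YZ≈W with H-inverse hY
  ... | Y′ , hY′ , _ , Y′Y≈I = resp (mul hY′ hW) (≈M-sym Z≈Y′W)
    where
    Z≈Y′W : Z ≈M (Y′ ⊗ W)
    Z≈Y′W = ≈M-trans (≈M-sym (⊗-identityˡ Z)) (≈M-trans (⊗-cong (≈M-sym Y′Y≈I) ≈M-refl)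
              (≈M-trans (⊗-assoc Y′ Y Z) (⊗-cong ≈M-refl YZ≈W)))

  module Solving {m} (ρ : Fin m → Fin n) (ρ-injective : ∀ {s t} → ρ s ≡ ρ t → s ≡ t) where
    open Tracked ρ ρ-injective

    Known : List (Step m) → Set (ℓ₁ ⊔ ℓ₂)
    Known = All (H ∘ letter)

    word-in : ∀ {ss} → Known ss → H (word ss)
    word-in []         = one
    word-in (hs ∷ hss) = mul hs (word-in hss)

    solve-for : ∀ (rel : Relation m) → Holds rel → ∀ xs {z ys} → proj₁ rel ≡ xs ++ z ∷ ys →
                Known xs → Known ys → Known (proj₂ rel) → H (letter z)
    solve-for (_ , ts) holds xs {z} {ys} P.refl hxs hys hts =
      cancelʳ (word-in hys) (cancelˡ (word-in hxs) (word-in hts) (≈M-trans (≈M-sym (word-++ xs (z ∷ ys))) lhs≈rhs)) ≈M-refl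
      where lhs≈rhs = word-relation (xs ++ z ∷ ys , ts) holds

  module OneRowSolving (r : Fin n) = Solving (λ _ → r) (λ _ → fin1-unique)
  module TwoRowSolving {p q : Fin n} (p≢q : p ≢ q) = Solving (vec₂ p q) (vec₂-injective p≢q)
  module ThreeRowSolving {r m c : Fin n} (r≢m : r ≢ m) (m≢c : m ≢ c) (r≢c : r ≢ c) =
    Solving (vec₃ r m c) (vec₃-injective r≢m m≢c r≢c)

-- An invertible matrix has
-- trivial kernel; column by column, a pivot is normalised to 1 and the rest
-- of its column cleared by row operations, each undone by a member of ⟨ gs ⟩.
module Elimination {ℓ₁ ℓ₂ : Level} (F : FiniteField ℓ₁ ℓ₂) (n : ℕ) {k : ℕ}
  (gs : Fin k → Matrices.Mat F n) (gs-invertible : ∀ j → Matrices.Invertible F n (gs j)) where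
  open FieldTheory F
  open ElementaryMatrices F n
  open Subgroup F n gs gs-invertible

  _·_ : Mat → (Fin n → Carrier) → Fin n → Carrier
  (A · u) x = ∑ (λ j → A x j * u j)

  TrivialKernel : Mat → Set (ℓ₁ ⊔ ℓ₂)
  TrivialKernel A = ∀ u → (∀ x → (A · u) x ≈ 0#) → ∀ j → u j ≈ 0#

  Reduced : ℕ → Mat → Set ℓ₂
  Reduced k A = ∀ x j → toℕ j < k → A x j ≈ I x j

  invertible⇒trivialKernel : ∀ {M} → Invertible M → TrivialKernel M
  invertible⇒trivialKernel {M} (B , _ , BM≈I) u Mu≈0 j = begin
    u j                          ≈⟨ sym (⊗-identityˡ (λ x _ → u x) j j) ⟩
    (I ⊗ (λ x _ → u x)) j j       ≈⟨ ⊗-cong (≈M-sym BM≈I) ≈M-refl j j ⟩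
    ((B ⊗ M) ⊗ (λ x _ → u x)) j j ≈⟨ ⊗-assoc B M (λ x _ → u x) j j ⟩
    ∑ (λ l → B j l * (M · u) l)   ≈⟨ ∑-0 {n} _ (λ l → trans (*-congˡ (Mu≈0 l)) (zeroʳ _)) ⟩
    0#                            ∎

  ·-rowOperation-target : ∀ r c α β A u → (rowOperation r c α β A · u) r ≈ α * (A · u) r + β * (A · u) c
  ·-rowOperation-target r c α β A u = begin
    ∑ (λ j → rowOp r c α β (column j A) r * u j)              ≈⟨ ∑-cong {n} (λ j → *-congʳ (reflexive (rowOp-target r c α β (column j A)))) ⟩
    ∑ (λ j → (α * A r j + β * A c j) * u j)                   ≈⟨ ∑-cong {n} (λ j → solve 5 (λ α β a b u →
                                                                   (α :* a :+ β :* b) :* u := α :* (a :* u) :+ β :* (b :* u)) refl α β (A r j) (A c j) (u j)) ⟩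
    ∑ (λ j → α * (A r j * u j) + β * (A c j * u j))            ≈⟨ ∑-+ {n} _ _ ⟩
    ∑ (λ j → α * (A r j * u j)) + ∑ (λ j → β * (A c j * u j))  ≈⟨ +-cong (∑-*ˡ {n} α _) (∑-*ˡ {n} β _) ⟩
    α * (A · u) r + β * (A · u) c                              ∎

  ·-rowOperation-other : ∀ {x r} → x ≢ r → ∀ c α β A u → (rowOperation r c α β A · u) x ≈ (A · u) x
  ·-rowOperation-other x≢r c α β A u = ∑-cong {n} (λ j → *-congʳ (reflexive (rowOp-other x≢r c α β (column j A))))

  trivialKernel-rowOperation : ∀ {r c α β A} → TrivialKernel A → α ≉ 0# → (r ≢ c ⊎ β ≈ 0#) →
                               TrivialKernel (rowOperation r c α β A)
  trivialKernel-rowOperation {r} {c} {α} {β} {A} ker α≉0 side u A′u≈0 = ker u Au≈0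
    where
    Au≈0 : ∀ x → (A · u) x ≈ 0#
    Au≈0 x with x Fin.≟ r
    ... | no x≢r     = trans (sym (·-rowOperation-other x≢r c α β A u)) (A′u≈0 x)
    ... | yes P.refl = zero-product α≉0 (trans (sym (drop-source side)) (trans (sym (·-rowOperation-target x c α β A u)) (A′u≈0 x)))
      where
      drop-source : x ≢ c ⊎ β ≈ 0# → α * (A · u) x + β * (A · u) c ≈ α * (A · u) x
      drop-source (inj₁ x≢c) = trans (+-congˡ (trans (*-congˡ (trans (sym (·-rowOperation-other (x≢c ∘ P.sym) c α β A u)) (A′u≈0 c))) (zeroʳ β))) (+-identityʳ _)
      drop-source (inj₂ β≈0) = trans (+-congˡ (trans (*-congʳ β≈0) (zeroˡ _))) (+-identityʳ _)

  reduced-rowOperation : ∀ {k r c α β A} → Reduced k A → (∀ j → toℕ j < k → A c j ≈ 0#) →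
                         (∀ j → toℕ j < k → α * I r j ≈ I r j) → Reduced k (rowOperation r c α β A)
  reduced-rowOperation {k} {r} {c} {α} {β} {A} red c-zero α-fixes x j j<k with x Fin.≟ r
  ... | no _       = red x j j<k
  ... | yes P.refl = begin
    α * A x j + β * A c j  ≈⟨ +-cong (*-congˡ (red x j j<k)) (*-congˡ (c-zero j j<k)) ⟩
    α * I x j + β * 0#     ≈⟨ trans (+-congˡ (zeroʳ β)) (+-identityʳ _) ⟩
    α * I x j              ≈⟨ α-fixes j j<k ⟩
    I x j                  ∎

  pivot : ∀ {A} → TrivialKernel A → (c : Fin n) → Reduced (toℕ c) A → ∃ λ p → toℕ c ≤ toℕ p × A p c ≉ 0#
  pivot {A} ker c red with FinP.any? (λ p → (toℕ c ℕ.≤? toℕ p) ×-dec ¬? (A p c ≟ 0#))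
  ... | yes found = found
  ... | no none   = ⊥-elim (1≉0 (trans (sym u-c≈1) (ker u Au≈0 c)))
    where
    -- otherwise u = e_c - ∑_{j < c} A j c e_j lies in the kernel
    w : Fin n → Carrier
    w j with toℕ j ℕ.<? toℕ c
    ... | yes _ = - A j c
    ... | no _  = 0#
    u : Fin n → Carrier
    u j = I j c + w j
    A-on-w : ∀ x j → A x j * w j ≈ I x j * w j
    A-on-w x j with toℕ j ℕ.<? toℕ c
    ... | yes j<c = *-congʳ (red x j j<c)
    ... | no _    = trans (zeroʳ _) (sym (zeroʳ _))
    column-cancels : ∀ x → A x c + w x ≈ 0#
    column-cancels x with toℕ x ℕ.<? toℕ c
    ... | yes _ = -‿inverseʳ _
    ... | no x≮c with ≈-dec (A x c) 0#
    ...   | inj₁ Axc≈0 = trans (+-identityʳ _) Axc≈0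
    ...   | inj₂ Axc≉0 = ⊥-elim (none (x , ℕP.≮⇒≥ x≮c , Axc≉0))
    Au≈0 : ∀ x → (A · u) x ≈ 0#
    Au≈0 x = begin
      ∑ (λ j → A x j * (I j c + w j))              ≈⟨ ∑-cong {n} (λ j → distribˡ _ _ _) ⟩
      ∑ (λ j → A x j * I j c + A x j * w j)         ≈⟨ ∑-+ {n} _ _ ⟩
      ∑ (λ j → A x j * I j c) + ∑ (λ j → A x j * w j) ≈⟨ +-cong (∑-δʳ c (A x)) (∑-cong {n} (A-on-w x)) ⟩
      A x c + ∑ (λ j → I x j * w j)                 ≈⟨ +-congˡ (∑-δ x w) ⟩
      A x c + w x                                   ≈⟨ column-cancels x ⟩
      0#                                            ∎
    u-c≈1 : u c ≈ 1#
    u-c≈1 with toℕ c ℕ.<? toℕ c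
    ... | yes c<c = ⊥-elim (ℕP.<-irrefl P.refl c<c)
    ... | no _    = trans (+-identityʳ _) (I-diag c)

  module FromElementary (transvection-in : ∀ r c → r ≢ c → ∀ a → H (T r c a))
                        (dilation-in : ∀ r d → d ≉ 0# → H (D r d)) where

    undo : ∀ {r c α β A} → H (E r c α β) → H (rowOperation r c α β A) → H A
    undo {r} {c} {α} {β} {A} hE hA′ = cancelˡ hE hA′ (E-act r c α β A)

    reduced-zero : ∀ {A} {c p : Fin n} → Reduced (toℕ c) A → toℕ c ≤ toℕ p → ∀ j → toℕ j < toℕ c → A p j ≈ 0#
    reduced-zero {A} {c} {p} red c≤p j j<c =
      trans (red p j j<c) (I-off (λ p≡j → ℕP.<⇒≱ j<c (P.subst (λ z → toℕ c ≤ toℕ z) p≡j c≤p)))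

    normalise : ∀ {A} (c : Fin n) → TrivialKernel A → Reduced (toℕ c) A →
                ∃ λ B → TrivialKernel B × Reduced (toℕ c) B × B c c ≈ 1# × (H B → H A)
    normalise {A} c ker red with pivot ker c red
    ... | p , c≤p , Apc≉0 with p Fin.≟ c
    ... | yes P.refl = rowOperation p p μ 0# A ,
        trivialKernel-rowOperation ker μ≉0 (inj₂ refl) ,
        reduced-rowOperation red (reduced-zero red c≤p)
          (λ j j<p → trans (*-congˡ (I-off (p≢j j j<p))) (trans (zeroʳ _) (sym (I-off (p≢j j j<p))))) ,
        trans (reflexive (rowOp-target p p μ 0# (column p A))) (trans (+-congˡ (zeroˡ _))
          (trans (+-identityʳ _) (⁻¹-inverseˡ (A p p) Apc≉0))) ,
        undo (dilation-in p μ μ≉0)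
      where
      μ = A p p ⁻¹[ Apc≉0 ]
      μ≉0 = ⁻¹-nonzero (A p p) Apc≉0
      p≢j : ∀ j → toℕ j < toℕ p → p ≢ j
      p≢j j j<p p≡j = ℕP.<-irrefl (P.cong toℕ (P.sym p≡j)) j<p
    ... | no p≢c = rowOperation c p 1# a A ,
        trivialKernel-rowOperation ker 1≉0 (inj₁ (p≢c ∘ P.sym)) ,
        reduced-rowOperation red (reduced-zero red c≤p) (λ j _ → *-identityˡ _) ,
        pivot-is-one ,
        undo (transvection-in c p (p≢c ∘ P.sym) a)
      where
      a = (1# - A c c) * A p c ⁻¹[ Apc≉0 ]
      pivot-is-one : rowOperation c p 1# a A c c ≈ 1#
      pivot-is-one = begin
        rowOp c p 1# a (column c A) c                                  ≡⟨ rowOp-target c p 1# a (column c A) ⟩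
        1# * A c c + ((1# - A c c) * A p c ⁻¹[ Apc≉0 ]) * A p c        ≈⟨ +-congˡ (*-assoc _ _ _) ⟩
        1# * A c c + (1# - A c c) * (A p c ⁻¹[ Apc≉0 ] * A p c)        ≈⟨ +-congˡ (*-congˡ (⁻¹-inverseˡ _ Apc≉0)) ⟩
        1# * A c c + (1# - A c c) * 1#                                 ≈⟨ solve 1 (λ x → con (+ 1) :* x :+ (con (+ 1) :- x) :* con (+ 1) := con (+ 1)) refl (A c c) ⟩
        1#                                                             ∎

    clear : ∀ (c : Fin n) t → t ≤ n → ∀ B → TrivialKernel B → Reduced (toℕ c) B → B c c ≈ 1# →
            (∀ x → t ≤ toℕ x → x ≢ c → B x c ≈ 0#) →
            ∃ λ B′ → TrivialKernel B′ × Reduced (suc (toℕ c)) B′ × (H B′ → H B)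
    clear c zero _ B ker red Bcc≈1 cleared = B , ker , red′ , λ hB → hB
      where
      red′ : Reduced (suc (toℕ c)) B
      red′ x j j≤c with ℕP.m≤n⇒m<n∨m≡n (ℕP.≤-pred j≤c)
      ... | inj₁ j<c = red x j j<c
      ... | inj₂ j≡c with FinP.toℕ-injective j≡c
      ...   | P.refl with x Fin.≟ j
      ...     | yes P.refl = Bcc≈1
      ...     | no x≢j     = cleared x z≤n x≢j
    clear c (suc t) t<n B ker red Bcc≈1 cleared with Fin.fromℕ< t<n Fin.≟ c
    ... | yes x₀≡c = clear c t (ℕP.<⇒≤ t<n) B ker red Bcc≈1 cleared′
      where
      cleared′ : ∀ x → t ≤ toℕ x → x ≢ c → B x c ≈ 0#
      cleared′ x t≤x x≢c with ℕP.m≤n⇒m<n∨m≡n t≤x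
      ... | inj₁ t<x = cleared x t<x x≢c
      ... | inj₂ t≡x = ⊥-elim (x≢c (P.trans (FinP.toℕ-injective (P.trans (P.sym t≡x) (P.sym (FinP.toℕ-fromℕ< t<n)))) x₀≡c))
    ... | no x₀≢c with clear c t (ℕP.<⇒≤ t<n) B′ ker′ red′ B′cc≈1 cleared′
      where
      x₀ = Fin.fromℕ< t<n
      B′ = rowOperation x₀ c 1# (- B x₀ c) B
      ker′ = trivialKernel-rowOperation ker 1≉0 (inj₁ x₀≢c)
      red′ : Reduced (toℕ c) B′
      red′ = reduced-rowOperation red (reduced-zero red ℕP.≤-refl) (λ j _ → *-identityˡ _)
      B′cc≈1 : B′ c c ≈ 1#
      B′cc≈1 = trans (reflexive (rowOp-other (x₀≢c ∘ P.sym) c 1# (- B x₀ c) (column c B))) Bcc≈1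
      cleared′ : ∀ x → t ≤ toℕ x → x ≢ c → B′ x c ≈ 0#
      cleared′ x t≤x x≢c with x Fin.≟ x₀
      ... | yes P.refl = trans (+-congˡ (*-congˡ Bcc≈1))
                           (solve 1 (λ b → con (+ 1) :* b :+ (:- b) :* con (+ 1) := con (+ 0)) refl (B x c))
      ... | no x≢x₀ with ℕP.m≤n⇒m<n∨m≡n t≤x
      ...   | inj₁ t<x = cleared x t<x x≢c
      ...   | inj₂ t≡x = ⊥-elim (x≢x₀ (FinP.toℕ-injective (P.trans (P.sym t≡x) (P.sym (FinP.toℕ-fromℕ< t<n)))))
    ... | B″ , ker″ , red″ , back = B″ , ker″ , red″ , undo (transvection-in x₀ c x₀≢c (- B x₀ c)) ∘ back
      where x₀ = Fin.fromℕ< t<n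

    reduce-column : ∀ (c : Fin n) A → TrivialKernel A → Reduced (toℕ c) A →
                    ∃ λ B → TrivialKernel B × Reduced (suc (toℕ c)) B × (H B → H A)
    reduce-column c A ker red with normalise c ker red
    ... | B , kerB , redB , Bcc≈1 , backB
      with clear c n ℕP.≤-refl B kerB redB Bcc≈1 (λ x n≤x _ → ⊥-elim (ℕP.<⇒≱ (FinP.toℕ<n x) n≤x))
    ... | B′ , kerB′ , redB′ , backB′ = B′ , kerB′ , redB′ , backB ∘ backB′

    reduce : ∀ d k → k ℕ.+ d ≡ n → ∀ A → TrivialKernel A → Reduced k A → H A
    reduce zero k k≡n A ker red = resp one (≈M-sym A≈I)
      where
      A≈I : A ≈M I
      A≈I x j = red x j (P.subst (toℕ j <_) (P.sym (P.trans (P.sym (ℕP.+-identityʳ k)) k≡n)) (FinP.toℕ<n j))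
    reduce (suc d) k k+d+1≡n A ker red = reduce-at (Fin.fromℕ< k<n) (FinP.toℕ-fromℕ< k<n)
      where
      k<n : k < n
      k<n = P.subst (k <_) k+d+1≡n (ℕP.m<m+n k (s≤s z≤n))
      reduce-at : ∀ c → toℕ c ≡ k → H A
      reduce-at c toℕc≡k with reduce-column c A ker (P.subst (λ i → Reduced i A) (P.sym toℕc≡k) red)
      ... | B , kerB , redB , back = back (reduce d (suc k) (P.trans (P.sym (ℕP.+-suc k d)) k+d+1≡n) B kerB
                                       (P.subst (λ i → Reduced (suc i) B) toℕc≡k redB))

    generates : GeneratesGL gs
    generates M M-invertible = reduce n 0 P.refl M (invertible⇒trivialKernel M-invertible) (λ x j ())

data LastOrInner : ∀ {k} → Fin (suc k) → Set where
  last  : ∀ {k} → LastOrInner (Fin.fromℕ k)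
  inner : ∀ {k} (i : Fin k) → LastOrInner (Fin.inject₁ i)

lastOrInner : ∀ {k} (j : Fin (suc k)) → LastOrInner j
lastOrInner {zero}  Fin.zero    = last
lastOrInner {suc k} Fin.zero    = inner Fin.zero
lastOrInner {suc k} (Fin.suc j) with lastOrInner j
... | last    = last
... | inner i = inner (Fin.suc i)

lastOrInner-last : ∀ k → lastOrInner (Fin.fromℕ k) ≡ last
lastOrInner-last zero = P.refl
lastOrInner-last (suc k) rewrite lastOrInner-last k = P.refl

lastOrInner-inner : ∀ {k} (i : Fin k) → lastOrInner (Fin.inject₁ i) ≡ inner i
lastOrInner-inner {suc k} Fin.zero    = P.refl
lastOrInner-inner {suc k} (Fin.suc i) rewrite lastOrInner-inner i = P.refl

module Instructions {ℓ₁ ℓ₂ : Level} (F : FiniteField ℓ₁ ℓ₂) (m : ℕ) where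
  open FieldTheory F

  N : ℕ
  N = suc (suc m)

  open ElementaryMatrices F N

  o L : Fin N
  o = Fin.zero
  L = Fin.fromℕ (suc m)

  toℕ-L : toℕ L ≡ suc m
  toℕ-L = FinP.toℕ-fromℕ (suc m)

  o≢L : o ≢ L
  o≢L o≡L = ℕP.0≢1+n (P.trans (P.cong toℕ o≡L) toℕ-L)

  inject≢suc : ∀ (i : Fin (suc m)) → Fin.inject₁ i ≢ Fin.suc i
  inject≢suc i i≡1+i = ℕP.1+n≢n (P.sym (P.trans (P.sym (FinP.toℕ-inject₁ i)) (P.cong toℕ i≡1+i)))

  module _ (g : Carrier) (g≉0 : g ≉ 0#) where

    y : Mat
    y = E L o g 1#

    generator : (j : Fin N) → LastOrInner j → Mat
    generator _ last      = y
    generator _ (inner i) = T (Fin.inject₁ i) (Fin.suc i) 1#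

    gs : Fin N → Mat
    gs j = generator j (lastOrInner j)

    partner : (j : Fin N) → LastOrInner j → Fin N
    partner _ last      = o
    partner _ (inner i) = Fin.suc i

    partner-≢ : (j : Fin N) (v : LastOrInner j) → j ≢ partner j v
    partner-≢ _ last      = o≢L ∘ P.sym
    partner-≢ _ (inner i) = inject≢suc i

    gs-instruction : ∀ j → IsInstruction (gs j)
    gs-instruction j with lastOrInner j
    ... | last    = E-instruction (o≢L ∘ P.sym) 1# g≉0
    ... | inner i = E-instruction (inject≢suc i) 1# 1≉0

    gs-invertible : ∀ j → Invertible (gs j)
    gs-invertible j with lastOrInner j
    ... | last    = E-invertible (o≢L ∘ P.sym) g 1# g≉0
    ... | inner i = E-invertible (inject≢suc i) 1# 1# 1≉0

    -- gs j has a 1 at (j, partner j), where every other generator agrees with I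
    gs-source : ∀ j → gs j j (partner j (lastOrInner j)) ≈ 1#
    gs-source j with lastOrInner j
    ... | last    = E-source (o≢L ∘ P.sym) g 1#
    ... | inner i = E-source (inject≢suc i) 1# 1#

    gs-other-row : ∀ {x} j → x ≢ j → ∀ col → gs j x col ≈ I x col
    gs-other-row j x≢j col with lastOrInner j
    ... | last    = E-other-row x≢j o g 1# col
    ... | inner i = E-other-row x≢j (Fin.suc i) 1# 1# col

    gs-distinct : ∀ j k → j ≢ k → ¬ (gs j ≈M gs k)
    gs-distinct j k j≢k gsj≈gsk = 1≉0 (begin
      1#            ≈⟨ sym (gs-source j) ⟩
      gs j j col    ≈⟨ gsj≈gsk j col ⟩
      gs k j col    ≈⟨ gs-other-row k j≢k col ⟩
      I j col       ≈⟨ I-off (partner-≢ j (lastOrInner j)) ⟩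
      0#            ∎)
      where col = partner j (lastOrInner j)

    module Generation (g-generates : ∀ d → d ≉ 0# → ∃ λ k → g ^ k ≈ d) where
      open Subgroup F N gs gs-invertible

      y-in : H y
      y-in = P.subst (λ v → H (generator L v)) (lastOrInner-last (suc m)) (gen L)

      adjacent-in : ∀ (i : Fin (suc m)) → H (T (Fin.inject₁ i) (Fin.suc i) 1#)
      adjacent-in i = P.subst (λ v → H (generator (Fin.inject₁ i) v)) (lastOrInner-inner i) (gen (Fin.inject₁ i))

      -- T r c 1 for r < c: adjacent ones are generators, the others commutators of shorter ones
      forward-in : ∀ d (r c : Fin N) → toℕ c ≡ toℕ r ℕ.+ suc d → H (T r c 1#)
      forward-in zero r c c≡r+1 with lastOrInner r
      ... | last    = ⊥-elim (ℕP.<-irrefl (P.trans c≡r+1 (P.trans (P.cong (ℕ._+ 1) toℕ-L) (ℕP.+-comm (suc m) 1))) (FinP.toℕ<n c))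
      ... | inner i = P.subst (λ z → H (T (Fin.inject₁ i) z 1#)) c≡1+i (adjacent-in i)
        where
        c≡1+i : Fin.suc i ≡ c
        c≡1+i = FinP.toℕ-injective (P.sym (P.trans c≡r+1 (P.trans (ℕP.+-comm _ 1) (P.cong suc (FinP.toℕ-inject₁ i)))))
      forward-in (suc d) r c c≡r+d+2 =
        resp (solve-for (commutator 1# 1#) (commutator-holds 1# 1#) [] P.refl [] (T-mc ∷ T-rm ∷ []) (T-rm ∷ T-mc ∷ []))
             (E-cong r c refl (*-identityˡ 1#))
        where
        mid<N : toℕ r ℕ.+ suc d < N
        mid<N = ℕP.<-trans (ℕP.+-monoʳ-< (toℕ r) (ℕP.n<1+n (suc d))) (P.subst (_< N) c≡r+d+2 (FinP.toℕ<n c))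
        mid : Fin N
        mid = Fin.fromℕ< mid<N
        toℕ-mid : toℕ mid ≡ toℕ r ℕ.+ suc d
        toℕ-mid = FinP.toℕ-fromℕ< mid<N
        ≢-by-toℕ : ∀ {a b : Fin N} → toℕ a ≢ toℕ b → a ≢ b
        ≢-by-toℕ ne a≡b = ne (P.cong toℕ a≡b)
        r≢mid : r ≢ mid
        r≢mid = ≢-by-toℕ (λ e → ℕP.m≢1+m+n (toℕ r) (P.trans e (P.trans toℕ-mid (ℕP.+-suc (toℕ r) d))))
        mid≢c : mid ≢ c
        mid≢c = ≢-by-toℕ (λ e → ℕP.1+n≢n (P.sym (P.trans (P.sym toℕ-mid) (P.trans e (P.trans c≡r+d+2 (ℕP.+-suc (toℕ r) (suc d)))))))
        r≢c : r ≢ c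
        r≢c = ≢-by-toℕ (λ e → ℕP.m≢1+m+n (toℕ r) (P.trans e (P.trans c≡r+d+2 (ℕP.+-suc (toℕ r) (suc d)))))
        open ThreeRowSolving r≢mid mid≢c r≢c
        T-rm : H (T r mid 1#)
        T-rm = forward-in d r mid toℕ-mid
        T-mc : H (T mid c 1#)
        T-mc = forward-in zero mid c (P.trans c≡r+d+2 (P.trans (ℕP.+-suc (toℕ r) (suc d))
                 (P.trans (P.cong suc (P.sym toℕ-mid)) (ℕP.+-comm 1 (toℕ mid)))))

      forward : ∀ {r c : Fin N} → toℕ r < toℕ c → H (T r c 1#)
      forward {r} {c} r<c = forward-in (toℕ c ℕ.∸ suc (toℕ r)) r c (P.sym (P.trans (ℕP.+-suc (toℕ r) _) (ℕP.m+[n∸m]≡n r<c)))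

      x-in : H (T o L 1#)
      x-in = forward (P.subst (0 <_) (P.sym toℕ-L) (s≤s z≤n))

      below-L : ∀ {r} → r ≢ L → toℕ r < toℕ L
      below-L {r} r≢L = P.subst (toℕ r <_) (P.sym toℕ-L)
        (ℕP.≤∧≢⇒< (FinP.toℕ≤pred[n] r) (λ r≡ → r≢L (FinP.toℕ-injective (P.trans r≡ (P.sym toℕ-L)))))

      above-o : ∀ {c} → c ≢ o → toℕ o < toℕ c
      above-o {Fin.zero}  c≢o = ⊥-elim (c≢o P.refl)
      above-o {Fin.suc _} _   = s≤s z≤n

      negate : ∀ {r c} → r ≢ c → ∀ {b} → H (T r c b) → H (T r c (- b))
      negate r≢c {b} T-in = solve-for (transvection-inverse b) (transvection-inverse-holds b) (tr p q b ∷ []) P.refl (T-in ∷ []) [] []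
        where open TwoRowSolving r≢c

      back-in : H (T L o 1#)
      back-in = solve-for (transposed g) (transposed-holds g) [] P.refl []
                  (y-in ∷ x⁻¹-in ∷ y-in ∷ []) (y-in ∷ x⁻¹-in ∷ y-in ∷ x⁻¹-in ∷ [])
        where
        open TwoRowSolving o≢L
        x⁻¹-in = negate o≢L x-in

      D-g-in : H (D L g)
      D-g-in = solve-for (dilation-from g) (dilation-from-holds g) [] P.refl [] [] (negate (o≢L ∘ P.sym) back-in ∷ y-in ∷ [])
        where open TwoRowSolving o≢L

      D-power-in : ∀ k → H (D L (g ^ k))
      D-power-in zero    = resp one (≈M-sym (E-identity L L refl refl))
      D-power-in (suc k) = solve-for (dilation-compose g (g ^ k)) (dilation-compose-holds g (g ^ k)) [] P.refl [] []
                             (D-g-in ∷ D-power-in k ∷ [])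
        where open OneRowSolving L

      D-L-in : ∀ d → d ≉ 0# → H (D L d)
      D-L-in d d≉0 with g-generates d d≉0
      ... | k , gᵏ≈d = resp (D-power-in k) (E-cong L L gᵏ≈d refl)

      T-zero : ∀ r c {a} → a ≈ 0# → H (T r c a)
      T-zero r c a≈0 = resp one (≈M-sym (E-identity r c refl a≈0))

      -- all transvections T L o a, by conjugating T L o 1 with D L a
      back-scaled-in : ∀ a → H (T L o a)
      back-scaled-in a with ≈-dec a 0#
      ... | inj₁ a≈0 = T-zero L o a≈0
      ... | inj₂ a≉0 = solve-for (scale-target a) (scale-target-holds a) [] P.refl [] (D-L-in a a≉0 ∷ [])
                         (D-L-in a a≉0 ∷ back-in ∷ [])
        where open TwoRowSolving (o≢L ∘ P.sym)

      -- all transvections T r L a, by conjugating T r L 1 with D L a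
      into-L-in : ∀ r → r ≢ L → ∀ a → H (T r L a)
      into-L-in r r≢L a with ≈-dec a 0#
      ... | inj₁ a≈0 = T-zero r L a≈0
      ... | inj₂ a≉0 = solve-for (scale-source a) (scale-source-holds a) (dil q a ∷ []) P.refl (D-L-in a a≉0 ∷ []) []
                         (forward (below-L r≢L) ∷ D-L-in a a≉0 ∷ [])
        where open TwoRowSolving r≢L

      -- all transvections T L c a, as commutators of T L o a and T o c 1
      from-L-in : ∀ c → c ≢ L → ∀ a → H (T L c a)
      from-L-in c c≢L a with c Fin.≟ o
      ... | yes P.refl = back-scaled-in a
      ... | no c≢o = resp (solve-for (commutator a 1#) (commutator-holds a 1#) [] P.refl []
                             (forward (above-o c≢o) ∷ back-scaled-in a ∷ []) (back-scaled-in a ∷ forward (above-o c≢o) ∷ []))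
                          (E-cong L c refl (*-identityʳ a))
        where open ThreeRowSolving (o≢L ∘ P.sym) (c≢o ∘ P.sym) (c≢L ∘ P.sym)

      transvection-in : ∀ r c → r ≢ c → ∀ a → H (T r c a)
      transvection-in r c r≢c a with r Fin.≟ L | c Fin.≟ L
      ... | yes P.refl | _          = from-L-in c (r≢c ∘ P.sym) a
      ... | no r≢L     | yes P.refl = into-L-in r r≢L a
      ... | no r≢L     | no c≢L     = resp (solve-for (commutator a 1#) (commutator-holds a 1#) [] P.refl []
                                            (from-L-in c c≢L 1# ∷ into-L-in r r≢L a ∷ []) (into-L-in r r≢L a ∷ from-L-in c c≢L 1# ∷ []))
                                          (E-cong r c refl (*-identityʳ a))
        where open ThreeRowSolving r≢L (c≢L ∘ P.sym) r≢c

      -- all dilations, by moving D L d to row r with w = T r L 1 · T L r (-1) · T r L 1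
      dilation-in : ∀ r d → d ≉ 0# → H (D r d)
      dilation-in r d d≉0 with r Fin.≟ L
      ... | yes P.refl = D-L-in d d≉0
      ... | no r≢L     = solve-for (swap-dilation d) (swap-dilation-holds d) [] P.refl []
                           (t ∷ t′ ∷ t ∷ []) (t ∷ t′ ∷ t ∷ D-L-in d d≉0 ∷ [])
        where
        open TwoRowSolving r≢L
        t  = into-L-in r r≢L 1#
        t′ = transvection-in L r (r≢L ∘ P.sym) (- 1#)

      generates : GeneratesGL gs
      generates = Elimination.FromElementary.generates F N gs gs-invertible transvection-in dilation-in

mainTheorem5 : ∀ {c ℓ} (F : FiniteField c ℓ) (n : ℕ) → 2 ≤ n →
    let open Matrices F n in
    ∃ λ (gs : Fin n → Mat) →
      (∀ j → IsInstruction (gs j)) ×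
      (∀ j k → ¬ (j ≡ k) → ¬ (gs j ≈M gs k)) ×
      GeneratesGL gs
mainTheorem5 F (suc (suc m)) (s≤s (s≤s z≤n)) with MultiplicativeGroup.primitiveElement F
... | g , g≉0 , g-generates =
  gs g g≉0 , gs-instruction g g≉0 , gs-distinct g g≉0 , Generation.generates g g≉0 g-generates
  where open Instructions F m
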